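{- Let $\mathsf{Mnm}$ be the full subcategory of $\mathsf T_\Sigma$ whose objects are the monomials (polynomials consisting of exactly one word $U\in\mathcal S^\star$), with monoidal product $\otimes$. Then $\mathsf{Mnm}\cong\mathsf C_\Sigma^+$ as symmetric strict monoidal categories.
   Context: Monoidal signature $(\mathcal S,\Sigma)$: sorts and generators with arity, coarity in $\mathcal S^\star$. $\mathsf C_\Sigma$: the free strict symmetric monoidal category on $\Sigma$ (objects words over $\mathcal S$, $\otimes$ concatenation, arrows string diagrams). A finite biproduct (fb) category: symmetric monoidal $(\mathsf C,\oplus,0)$ with natural commutative monoids $\nabla_X:X\oplus X\to X$, $\mathsf i_X:0\to X$ and cocommutative comonoids $\Delta_X:X\to X\oplus X$, $!_X:X\to0$ coherent with $\oplus$. $\mathsf T_\Sigma$: free strict fb category on the underlying category of $\mathsf C_\Sigma$; objects polynomials $U_1\oplus\cdots\oplus U_n$; arrows terms in $\mathrm{id}$, $\lceil c\rceil$ ($c$ in $\mathsf C_\Sigma$), $\sigma^\oplus$, $\Delta,!,\nabla,\mathsf i$, $;$, $\oplus$ modulo fb laws, naturality w.r.t. $\lceil c\rceil$, $\lceil\mathrm{id}\rceil=\mathrm{id}$, $\lceil c;d\rceil=\lceil c\rceil;\lceil d\rceil$. On monomials, the tensor of $\mathsf T_\Sigma$ is concatenation of words on objects and on arrows $t_1\otimes t_2=L_{U_1}(t_2);R_{V_2}(t_1)$ for $t_1:U_1\to V_1$, $t_2:U_2\to V_2$, where $L_U,R_U$ preserve $;$, $\oplus$, $\mathrm{id}_0$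 and $L_U(\lceil c\rceil)=\lceil\mathrm{id}_U\otimes c\rceil$, $R_U(\lceil c\rceil)=\lceil c\otimes\mathrm{id}_U\rceil$, $L_U(\sigma^\oplus_{V,W})=\sigma^\oplus_{UV,UW}$, $R_U(\sigma^\oplus_{V,W})=\sigma^\oplus_{VU,WU}$, $L_U(\Delta_V)=\Delta_{UV}$, $R_U(\Delta_V)=\Delta_{VU}$, similarly for $!,\nabla,\mathsf i$; the symmetry between monomials is $\lceil\sigma_{U,V}\rceil$. $\mathsf C_\Sigma^+$: same objects as $\mathsf C_\Sigma$, $\mathsf C_\Sigma^+[U,V]$ the finite multisets of arrows of $\mathsf C_\Sigma[U,V]$, composition $\{a;b\mid a\in f,b\in g\}$ with multiplied multiplicities, identity the singleton $\{\mathrm{id}_U\}$, monoidal product $f\otimes g=\{a\otimes b\mid a\in f,b\in g\}$, symmetries the singletons of symmetries. -}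

module Defs where

open import Data.List using (List; []; _∷_; _++_; [_]; map; cartesianProductWith)
open import Data.List.Properties using (++-assoc; map-++)
open import Relation.Binary.PropositionalEquality using (_≡_; refl; sym; trans; cong)
open import Relation.Binary.Bundles using (Setoid)
import Data.List.Relation.Binary.Permutation.Setoid as Perm

record Signature : Set₁ where
  field
    Sort : Set
    Gen  : Set
    ar   : Gen → List Sort
    coar : Gen → List Sort

module _ (Sg : Signature) where
  open Signature Sg

  Word : Set
  Word = List Sort

  -- Arrows: terms modulo the strict SMC laws
  -- (a heterogeneous relation, since associativity/unit of _++_
  -- only hold propositionally).

  infixl 5 _⨾_
  infixr 6 _⊗_

  data Diag : Word → Word → Set where
    id  : (U : Word) → Diag U U
    gen : (g : Gen) → Diag (ar g) (coar g)
    σ   : (U V : Word) → Diag (U ++ V) (V ++ U)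
    _⨾_ : ∀ {U V W} → Diag U V → Diag V W → Diag U W
    _⊗_ : ∀ {U V U′ V′} → Diag U V → Diag U′ V′ → Diag (U ++ U′) (V ++ V′)

  castD : ∀ {A A′ B B′} → A ≡ A′ → B ≡ B′ → Diag A B → Diag A′ B′
  castD refl refl f = f

  infix 4 _≈ᴰ_

  data _≈ᴰ_ : ∀ {A B C D} → Diag A B → Diag C D → Set where
    ≈refl  : ∀ {A B} {f : Diag A B} → f ≈ᴰ f
    ≈sym   : ∀ {A B C D} {f : Diag A B} {g : Diag C D} → f ≈ᴰ g → g ≈ᴰ f
    ≈trans : ∀ {A B C D E F} {f : Diag A B} {g : Diag C D} {h : Diag E F} →
             f ≈ᴰ g → g ≈ᴰ h → f ≈ᴰ h
    ⨾-cong : ∀ {A B C A′ B′ C′} {f : Diag A B} {g : Diag B C}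
               {f′ : Diag A′ B′} {g′ : Diag B′ C′} →
             f ≈ᴰ f′ → g ≈ᴰ g′ → f ⨾ g ≈ᴰ f′ ⨾ g′
    ⊗-cong : ∀ {A B C D A′ B′ C′ D′} {f : Diag A B} {g : Diag C D}
               {f′ : Diag A′ B′} {g′ : Diag C′ D′} →
             f ≈ᴰ f′ → g ≈ᴰ g′ → f ⊗ g ≈ᴰ f′ ⊗ g′
    idˡ   : ∀ {A B} (f : Diag A B) → id A ⨾ f ≈ᴰ f
    idʳ   : ∀ {A B} (f : Diag A B) → f ⨾ id B ≈ᴰ f
    assoc : ∀ {A B C D} (f : Diag A B) (g : Diag B C) (h : Diag C D) →
            (f ⨾ g) ⨾ h ≈ᴰ f ⨾ (g ⨾ h)
    ⊗-assoc  : ∀ {A B C D E F} (f : Diag A B) (g : Diag C D) (h : Diag E F) →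
               (f ⊗ g) ⊗ h ≈ᴰ f ⊗ (g ⊗ h)
    ⊗-unitˡ  : ∀ {A B} (f : Diag A B) → id [] ⊗ f ≈ᴰ f
    ⊗-unitʳ  : ∀ {A B} (f : Diag A B) → f ⊗ id [] ≈ᴰ f
    ⊗-id     : ∀ U V → id U ⊗ id V ≈ᴰ id (U ++ V)
    interchange : ∀ {A B C A′ B′ C′} (f : Diag A B) (g : Diag B C)
                    (f′ : Diag A′ B′) (g′ : Diag B′ C′) →
                  (f ⨾ g) ⊗ (f′ ⨾ g′) ≈ᴰ (f ⊗ f′) ⨾ (g ⊗ g′)
    σ-inv  : ∀ U V → σ U V ⨾ σ V U ≈ᴰ id (U ++ V)
    σ-nat  : ∀ {A B C D} (f : Diag A B) (g : Diag C D) →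
             (f ⊗ g) ⨾ σ B D ≈ᴰ σ A C ⨾ (g ⊗ f)
    σ-hex  : ∀ U V W →
             σ U (V ++ W) ≈ᴰ
               (σ U V ⊗ id W) ⨾ castD (sym (++-assoc V U W)) refl (id V ⊗ σ U W)
    σ-unit : ∀ U → σ U [] ≈ᴰ id U

  -- T_Σ : the free strict finite-biproduct category on C_Σ.
  -- Objects: polynomials (lists of words, ⊕ = _++_, 0 = []).

  Poly : Set
  Poly = List Word

  infixl 5 _⨾ₜ_
  infixr 6 _⊕_

  data Tape : Poly → Poly → Set where
    pid  : (X : Poly) → Tape X X
    ⌈_⌉  : ∀ {U V} → Diag U V → Tape [ U ] [ V ]
    σ⊕   : (X Y : Poly) → Tape (X ++ Y) (Y ++ X)
    Δ    : (X : Poly) → Tape X (X ++ X)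
    !    : (X : Poly) → Tape X []
    ∇    : (X : Poly) → Tape (X ++ X) X
    ¡    : (X : Poly) → Tape [] X
    _⨾ₜ_ : ∀ {X Y Z} → Tape X Y → Tape Y Z → Tape X Z
    _⊕_  : ∀ {X Y X′ Y′} → Tape X Y → Tape X′ Y′ → Tape (X ++ X′) (Y ++ Y′)

  castT : ∀ {X X′ Y Y′} → X ≡ X′ → Y ≡ Y′ → Tape X Y → Tape X′ Y′
  castT refl refl t = t

  mid-eq : ∀ (X Y : Poly) → X ++ ((X ++ Y) ++ Y) ≡ (X ++ X) ++ (Y ++ Y)
  mid-eq X Y = trans (cong (X ++_) (++-assoc X Y Y)) (sym (++-assoc X X (Y ++ Y)))

  infix 4 _≈ₜ_

  data _≈ₜ_ : ∀ {A B C D} → Tape A B → Tape C D → Set where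
    ≈refl  : ∀ {A B} {f : Tape A B} → f ≈ₜ f
    ≈sym   : ∀ {A B C D} {f : Tape A B} {g : Tape C D} → f ≈ₜ g → g ≈ₜ f
    ≈trans : ∀ {A B C D E F} {f : Tape A B} {g : Tape C D} {h : Tape E F} →
             f ≈ₜ g → g ≈ₜ h → f ≈ₜ h
    ⨾-cong : ∀ {A B C A′ B′ C′} {f : Tape A B} {g : Tape B C}
               {f′ : Tape A′ B′} {g′ : Tape B′ C′} →
             f ≈ₜ f′ → g ≈ₜ g′ → f ⨾ₜ g ≈ₜ f′ ⨾ₜ g′
    ⊕-cong : ∀ {A B C D A′ B′ C′ D′} {f : Tape A B} {g : Tape C D}
               {f′ : Tape A′ B′} {g′ : Tape C′ D′} →
             f ≈ₜ f′ → g ≈ₜ g′ → f ⊕ g ≈ₜ f′ ⊕ g′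
    ⌈⌉-cong : ∀ {A B C D} {c : Diag A B} {d : Diag C D} → c ≈ᴰ d → ⌈ c ⌉ ≈ₜ ⌈ d ⌉
    ⌈id⌉    : ∀ U → ⌈ id U ⌉ ≈ₜ pid [ U ]
    ⌈⨾⌉     : ∀ {U V W} (c : Diag U V) (d : Diag V W) → ⌈ c ⨾ d ⌉ ≈ₜ ⌈ c ⌉ ⨾ₜ ⌈ d ⌉
    idˡ   : ∀ {A B} (f : Tape A B) → pid A ⨾ₜ f ≈ₜ f
    idʳ   : ∀ {A B} (f : Tape A B) → f ⨾ₜ pid B ≈ₜ f
    assoc : ∀ {A B C D} (f : Tape A B) (g : Tape B C) (h : Tape C D) →
            (f ⨾ₜ g) ⨾ₜ h ≈ₜ f ⨾ₜ (g ⨾ₜ h)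
    ⊕-assoc  : ∀ {A B C D E F} (f : Tape A B) (g : Tape C D) (h : Tape E F) →
               (f ⊕ g) ⊕ h ≈ₜ f ⊕ (g ⊕ h)
    ⊕-unitˡ  : ∀ {A B} (f : Tape A B) → pid [] ⊕ f ≈ₜ f
    ⊕-unitʳ  : ∀ {A B} (f : Tape A B) → f ⊕ pid [] ≈ₜ f
    ⊕-id     : ∀ X Y → pid X ⊕ pid Y ≈ₜ pid (X ++ Y)
    interchange : ∀ {A B C A′ B′ C′} (f : Tape A B) (g : Tape B C)
                    (f′ : Tape A′ B′) (g′ : Tape B′ C′) →
                  (f ⨾ₜ g) ⊕ (f′ ⨾ₜ g′) ≈ₜ (f ⊕ f′) ⨾ₜ (g ⊕ g′)
    σ-inv  : ∀ X Y → σ⊕ X Y ⨾ₜ σ⊕ Y X ≈ₜ pid (X ++ Y)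
    σ-nat  : ∀ {A B C D} (f : Tape A B) (g : Tape C D) →
             (f ⊕ g) ⨾ₜ σ⊕ B D ≈ₜ σ⊕ A C ⨾ₜ (g ⊕ f)
    σ-hex  : ∀ X Y Z →
             σ⊕ X (Y ++ Z) ≈ₜ
               (σ⊕ X Y ⊕ pid Z) ⨾ₜ castT (sym (++-assoc Y X Z)) refl (pid Y ⊕ σ⊕ X Z)
    σ-unit : ∀ X → σ⊕ X [] ≈ₜ pid X
    ∇-assoc : ∀ X → (∇ X ⊕ pid X) ⨾ₜ ∇ X ≈ₜ (pid X ⊕ ∇ X) ⨾ₜ ∇ X
    ∇-unit  : ∀ X → (¡ X ⊕ pid X) ⨾ₜ ∇ X ≈ₜ pid X
    ∇-comm  : ∀ X → σ⊕ X X ⨾ₜ ∇ X ≈ₜ ∇ X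
    Δ-assoc : ∀ X → Δ X ⨾ₜ (Δ X ⊕ pid X) ≈ₜ Δ X ⨾ₜ (pid X ⊕ Δ X)
    Δ-unit  : ∀ X → Δ X ⨾ₜ (! X ⊕ pid X) ≈ₜ pid X
    Δ-comm  : ∀ X → Δ X ⨾ₜ σ⊕ X X ≈ₜ Δ X
    ∇-nat : ∀ {X Y} (t : Tape X Y) → ∇ X ⨾ₜ t ≈ₜ (t ⊕ t) ⨾ₜ ∇ Y
    ¡-nat : ∀ {X Y} (t : Tape X Y) → ¡ X ⨾ₜ t ≈ₜ ¡ Y
    Δ-nat : ∀ {X Y} (t : Tape X Y) → t ⨾ₜ Δ Y ≈ₜ Δ X ⨾ₜ (t ⊕ t)
    !-nat : ∀ {X Y} (t : Tape X Y) → t ⨾ₜ ! Y ≈ₜ ! X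
    ∇-⊕ : ∀ X Y → ∇ (X ++ Y) ≈ₜ
            (pid X ⊕ (σ⊕ Y X ⊕ pid Y)) ⨾ₜ castT (sym (mid-eq X Y)) refl (∇ X ⊕ ∇ Y)
    Δ-⊕ : ∀ X Y → Δ (X ++ Y) ≈ₜ
            castT refl (sym (mid-eq X Y)) (Δ X ⊕ Δ Y) ⨾ₜ (pid X ⊕ (σ⊕ X Y ⊕ pid Y))
    ¡-⊕ : ∀ X Y → ¡ (X ++ Y) ≈ₜ ¡ X ⊕ ¡ Y
    !-⊕ : ∀ X Y → ! (X ++ Y) ≈ₜ ! X ⊕ ! Y
    ∇-0 : ∇ [] ≈ₜ pid []
    Δ-0 : Δ [] ≈ₜ pid []
    ¡-0 : ¡ [] ≈ₜ pid []
    !-0 : ! [] ≈ₜ pid []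

  _·_ : Word → Poly → Poly
  U · X = map (U ++_) X

  _∙_ : Poly → Word → Poly
  X ∙ U = map (_++ U) X

  L : (U : Word) → ∀ {X Y} → Tape X Y → Tape (U · X) (U · Y)
  L U (pid X)   = pid (U · X)
  L U ⌈ c ⌉     = ⌈ id U ⊗ c ⌉
  L U (σ⊕ X Y)  = castT (sym (map-++ (U ++_) X Y)) (sym (map-++ (U ++_) Y X))
                        (σ⊕ (U · X) (U · Y))
  L U (Δ X)     = castT refl (sym (map-++ (U ++_) X X)) (Δ (U · X))
  L U (! X)     = ! (U · X)
  L U (∇ X)     = castT (sym (map-++ (U ++_) X X)) refl (∇ (U · X))
  L U (¡ X)     = ¡ (U · X)
  L U (t ⨾ₜ s)  = L U t ⨾ₜ L U s
  L U (_⊕_ {X} {Y} {X′} {Y′} t s) =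
    castT (sym (map-++ (U ++_) X X′)) (sym (map-++ (U ++_) Y Y′)) (L U t ⊕ L U s)

  R : (U : Word) → ∀ {X Y} → Tape X Y → Tape (X ∙ U) (Y ∙ U)
  R U (pid X)   = pid (X ∙ U)
  R U ⌈ c ⌉     = ⌈ c ⊗ id U ⌉
  R U (σ⊕ X Y)  = castT (sym (map-++ (_++ U) X Y)) (sym (map-++ (_++ U) Y X))
                        (σ⊕ (X ∙ U) (Y ∙ U))
  R U (Δ X)     = castT refl (sym (map-++ (_++ U) X X)) (Δ (X ∙ U))
  R U (! X)     = ! (X ∙ U)
  R U (∇ X)     = castT (sym (map-++ (_++ U) X X)) refl (∇ (X ∙ U))
  R U (¡ X)     = ¡ (X ∙ U)
  R U (t ⨾ₜ s)  = R U t ⨾ₜ R U s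
  R U (_⊕_ {X} {Y} {X′} {Y′} t s) =
    castT (sym (map-++ (_++ U) X X′)) (sym (map-++ (_++ U) Y Y′)) (R U t ⊕ R U s)

  infixr 6 _⊗ₘ_
  _⊗ₘ_ : ∀ {U₁ V₁ U₂ V₂} → Tape [ U₁ ] [ V₁ ] → Tape [ U₂ ] [ V₂ ] →
         Tape [ U₁ ++ U₂ ] [ V₁ ++ V₂ ]
  _⊗ₘ_ {U₁} {V₁} {U₂} {V₂} t₁ t₂ = L U₁ t₂ ⨾ₜ R V₂ t₁

  -- C_Σ⁺ : homs are finite multisets of arrows of C_Σ[U,V], i.e. lists
  -- of diagrams up to permutation and elementwise ≈ᴰ.

  DiagSetoid : Word → Word → Setoid _ _
  DiagSetoid U V = record
    { Carrier = Diag U V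
    ; _≈_ = λ f g → f ≈ᴰ g
    ; isEquivalence = record { refl = ≈refl ; sym = ≈sym ; trans = ≈trans }
    }

  Hom⁺ : Word → Word → Set
  Hom⁺ U V = List (Diag U V)

  infix 4 _≈⁺_
  _≈⁺_ : ∀ {U V} → Hom⁺ U V → Hom⁺ U V → Set
  _≈⁺_ {U} {V} = Perm._↭_ (DiagSetoid U V)

  id⁺ : (U : Word) → Hom⁺ U U
  id⁺ U = [ id U ]

  _⨾⁺_ : ∀ {U V W} → Hom⁺ U V → Hom⁺ V W → Hom⁺ U W
  f ⨾⁺ g = cartesianProductWith _⨾_ f g

  _⊗⁺_ : ∀ {U V U′ V′} → Hom⁺ U V → Hom⁺ U′ V′ → Hom⁺ (U ++ U′) (V ++ V′)
  f ⊗⁺ g = cartesianProductWith _⊗_ f g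

  σ⁺ : (U V : Word) → Hom⁺ (U ++ V) (V ++ U)
  σ⁺ U V = [ σ U V ]

  -- An isomorphism of symmetric strict monoidal categories Mnm ≅ C_Σ⁺,
  -- acting on objects as [ U ] ↦ U: a strict symmetric monoidal functor
  -- F (well defined on equivalence classes) with an inverse G on hom-sets.

  record MnmIsoCplus : Set where
    field
      F : ∀ {U V} → Tape [ U ] [ V ] → Hom⁺ U V
      G : ∀ {U V} → Hom⁺ U V → Tape [ U ] [ V ]
      F-cong : ∀ {U V} {t s : Tape [ U ] [ V ]} → t ≈ₜ s → F t ≈⁺ F s
      G-cong : ∀ {U V} {f g : Hom⁺ U V} → f ≈⁺ g → G f ≈ₜ G g
      F-id : ∀ U → F (pid [ U ]) ≈⁺ id⁺ U
      F-⨾  : ∀ {U V W} (t : Tape [ U ] [ V ]) (s : Tape [ V ] [ W ]) →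
             F (t ⨾ₜ s) ≈⁺ F t ⨾⁺ F s
      F-⊗  : ∀ {U₁ V₁ U₂ V₂} (t : Tape [ U₁ ] [ V₁ ]) (s : Tape [ U₂ ] [ V₂ ]) →
             F (t ⊗ₘ s) ≈⁺ F t ⊗⁺ F s
      F-σ  : ∀ U V → F ⌈ σ U V ⌉ ≈⁺ σ⁺ U V
      F∘G  : ∀ {U V} (f : Hom⁺ U V) → F (G f) ≈⁺ f
      G∘F  : ∀ {U V} (t : Tape [ U ] [ V ]) → G (F t) ≈ₜ t

-- A tape X → Y is read as a matrix of finite multisets of string diagrams, one entry for each
-- pair of monomials of X and Y.  We present it by its action ⟦ t ⟧ on rows: a row from W over X
-- assigns to every monomial U of X a multiset of diagrams W → U.  Then ⨾ₜ acts by matrix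
-- product, ⊕ blockwise, Δ and ∇ by copying and adding rows, ¡ and ! by the zero row, and all
-- the finite-biproduct laws hold, so ⟦_⟧ is sound for ≈ₜ.  The functor F reads off the single
-- entry of ⟦ t ⟧ on the unit row [ id U ]; the inverse G sends a multiset to the sum, in the
-- biproduct structure, of the tapes ⌈ f ⌉ of its elements.  F ∘ G ≈ id is a computation.
-- G ∘ F ≈ id follows from completeness on rows: realising a row v as a tape rowₜ v, one has
-- rowₜ v ⨾ₜ t ≈ₜ rowₜ (⟦ t ⟧ v), and the unit row realises the identity.  F preserves ⨾ₜ
-- because ⟦ t ⟧ is linear in its row, and preserves ⊗ because ⟦_⟧ commutes with the
-- whiskerings L and R, which act on rows by tensoring every entry.

module Submission where

open import Algebra.Bundles using (CommutativeMonoid)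
open import Algebra.Structures using (IsCommutativeMonoid)
open import Algebra.Structures.Biased using (isCommutativeMonoidˡ)
import Algebra.Properties.CommutativeSemigroup as CommutativeSemigroupProperties
open import Data.List using (List; []; _∷_; _++_; [_]; map; foldr; cartesianProductWith)
open import Data.List.Properties using (++-assoc; ++-identityʳ; map-++; cartesianProductWith-zeroʳ; cartesianProductWith-distribʳ-++)
open import Data.List.Relation.Unary.All using (All; []; _∷_; head)
open import Data.List.Relation.Unary.All.Properties using (++⁺; ++⁻)
import Data.List.Relation.Binary.Permutation.Setoid as Permutation
import Data.List.Relation.Binary.Permutation.Setoid.Properties as PermutationProperties
open import Data.Product using (_×_; _,_; proj₁; proj₂)
open import Relation.Binary.Bundles using (Setoid)
open import Relation.Binary.PropositionalEquality using (_≡_; refl; sym; trans; cong; cong₂)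
open import Defs hiding (_≈ᴰ_; _≈ₜ_; _≈⁺_; _⨾⁺_; _⊗⁺_; _⊗ₘ_)

++-middle : ∀ {a} {A : Set a} (xs ys : List A) → (xs ++ ys) ++ (xs ++ ys) ≡ xs ++ ((ys ++ xs) ++ ys)
++-middle xs ys = trans (++-assoc xs ys (xs ++ ys)) (cong (xs ++_) (sym (++-assoc ys xs ys)))

module _ (Sg : Signature) where

  infix 4 _≈ᴰ_ _≈ₜ_ _≈⁺_

  _≈ᴰ_ : ∀ {A B C D : Word Sg} → Diag Sg A B → Diag Sg C D → Set
  _≈ᴰ_ = Defs._≈ᴰ_ Sg

  _≈ₜ_ : ∀ {A B C D : Poly Sg} → Tape Sg A B → Tape Sg C D → Set
  _≈ₜ_ = Defs._≈ₜ_ Sg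

  _≈⁺_ : ∀ {U V : Word Sg} → Hom⁺ Sg U V → Hom⁺ Sg U V → Set
  _≈⁺_ = Defs._≈⁺_ Sg

  infixl 5 _⨾⁺_
  infixr 6 _⊗⁺_ _⊗ₘ_

  _⨾⁺_ : ∀ {U V W : Word Sg} → Hom⁺ Sg U V → Hom⁺ Sg V W → Hom⁺ Sg U W
  _⨾⁺_ = Defs._⨾⁺_ Sg

  _⊗⁺_ : ∀ {U V U′ V′ : Word Sg} → Hom⁺ Sg U V → Hom⁺ Sg U′ V′ → Hom⁺ Sg (U ++ U′) (V ++ V′)
  _⊗⁺_ = Defs._⊗⁺_ Sg

  _⊗ₘ_ : ∀ {U₁ V₁ U₂ V₂ : Word Sg} → Tape Sg [ U₁ ] [ V₁ ] → Tape Sg [ U₂ ] [ V₂ ] →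
         Tape Sg [ U₁ ++ U₂ ] [ V₁ ++ V₂ ]
  _⊗ₘ_ = Defs._⊗ₘ_ Sg

  module ↭ {U V : Word Sg} = Permutation (DiagSetoid Sg U V)
  module ↭ₚ {U V : Word Sg} = PermutationProperties (DiagSetoid Sg U V)

  ++-interchange⁺ : ∀ {U V} (p q r s : Hom⁺ Sg U V) → (p ++ q) ++ (r ++ s) ≈⁺ (p ++ r) ++ (q ++ s)
  ++-interchange⁺ {U} {V} = CommutativeSemigroupProperties.interchange
    (CommutativeMonoid.commutativeSemigroup (↭ₚ.++-commutativeMonoid {U} {V}))

  module _ {A B C D E F : Word Sg} (op : Diag Sg A B → Diag Sg C D → Diag Sg E F) where

    cartesianProductWith-distribˡ-++⁺ : ∀ g x y →
      cartesianProductWith op g (x ++ y) ≈⁺ cartesianProductWith op g x ++ cartesianProductWith op g y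
    cartesianProductWith-distribˡ-++⁺ [] x y = ↭.↭-refl
    cartesianProductWith-distribˡ-++⁺ (a ∷ g) x y = begin
      map (op a) (x ++ y) ++ cartesianProductWith op g (x ++ y)
        ≡⟨ cong (_++ cartesianProductWith op g (x ++ y)) (map-++ (op a) x y) ⟩
      (map (op a) x ++ map (op a) y) ++ cartesianProductWith op g (x ++ y)
        ↭⟨ ↭ₚ.++⁺ˡ (map (op a) x ++ map (op a) y) (cartesianProductWith-distribˡ-++⁺ g x y) ⟩
      (map (op a) x ++ map (op a) y) ++ (cartesianProductWith op g x ++ cartesianProductWith op g y)
        ↭⟨ ++-interchange⁺ (map (op a) x) (map (op a) y) _ _ ⟩
      (map (op a) x ++ cartesianProductWith op g x) ++ (map (op a) y ++ cartesianProductWith op g y) ∎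
      where open ↭.PermutationReasoning

    module _ {C′ D′ E′ F′ : Word Sg} (op′ : Diag Sg A B → Diag Sg C′ D′ → Diag Sg E′ F′)
             (φ : Diag Sg E F → Diag Sg E′ F′) (ψ : Diag Sg C D → Diag Sg C′ D′)
             (φ∘op≈op′∘ψ : ∀ a f → φ (op a f) ≈ᴰ op′ a (ψ f)) where

      map-cartesianProductWithʳ : ∀ g x →
        map φ (cartesianProductWith op g x) ≈⁺ cartesianProductWith op′ g (map ψ x)
      map-cartesianProductWithʳ [] x = ↭.↭-refl
      map-cartesianProductWithʳ (a ∷ g) x = ↭.↭-trans
        (↭.↭-reflexive (map-++ φ (map (op a) x) (cartesianProductWith op g x)))
        (↭ₚ.++⁺ (row x) (map-cartesianProductWithʳ g x))
        where
        row : ∀ x → map φ (map (op a) x) ≈⁺ map (op′ a) (map ψ x)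
        row [] = ↭.↭-refl {E′} {F′}
        row (f ∷ x) = ↭.prep {E′} {F′} (φ∘op≈op′∘ψ a f) (row x)

    module _ {A′ B′ E′ F′ : Word Sg} (op′ : Diag Sg A′ B′ → Diag Sg C D → Diag Sg E′ F′)
             (φ : Diag Sg E F → Diag Sg E′ F′) (ψ : Diag Sg A B → Diag Sg A′ B′)
             (φ∘op≈op′∘ψ : ∀ a f → φ (op a f) ≈ᴰ op′ (ψ a) f) where

      map-cartesianProductWithˡ : ∀ g x →
        map φ (cartesianProductWith op g x) ≈⁺ cartesianProductWith op′ (map ψ g) x
      map-cartesianProductWithˡ [] x = ↭.↭-refl
      map-cartesianProductWithˡ (a ∷ g) x = ↭.↭-trans
        (↭.↭-reflexive (map-++ φ (map (op a) x) (cartesianProductWith op g x)))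
        (↭ₚ.++⁺ (row x) (map-cartesianProductWithˡ g x))
        where
        row : ∀ x → map φ (map (op a) x) ≈⁺ map (op′ (ψ a)) x
        row [] = ↭.↭-refl {E′} {F′}
        row (f ∷ x) = ↭.prep {E′} {F′} (φ∘op≈op′∘ψ a f) (row x)

  Row : Word Sg → Poly Sg → Set
  Row W = All (Hom⁺ Sg W)

  infix 4 _≋_

  -- Heterogeneous in the index, since several axioms of ≈ₜ relate tapes whose types
  -- agree only up to propositional equalities such as ++-assoc.
  data _≋_ {W : Word Sg} : ∀ {X Y} → Row W X → Row W Y → Set where
    []  : [] ≋ []
    _∷_ : ∀ {U X Y} {x y : Hom⁺ Sg W U} {v : Row W X} {w : Row W Y} →
          x ≈⁺ y → v ≋ w → (x ∷ v) ≋ (y ∷ w)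

  module _ {W : Word Sg} where

    ≋-refl : ∀ {X} {v : Row W X} → v ≋ v
    ≋-refl {v = []} = []
    ≋-refl {v = x ∷ v} = ↭.↭-refl ∷ ≋-refl

    ≋-reflexive : ∀ {X} {v w : Row W X} → v ≡ w → v ≋ w
    ≋-reflexive refl = ≋-refl

    ≋-sym : ∀ {X Y} {v : Row W X} {w : Row W Y} → v ≋ w → w ≋ v
    ≋-sym [] = []
    ≋-sym (p ∷ ps) = ↭.↭-sym p ∷ ≋-sym ps

    ≋-trans : ∀ {X Y Z} {u : Row W X} {v : Row W Y} {w : Row W Z} → u ≋ v → v ≋ w → u ≋ w
    ≋-trans [] [] = []
    ≋-trans (p ∷ ps) (q ∷ qs) = ↭.↭-trans p q ∷ ≋-trans ps qs

    ++⁺-cong : ∀ {X X′ Y Y′} {a : Row W X} {a′ : Row W X′} {b : Row W Y} {b′ : Row W Y′} →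
               a ≋ a′ → b ≋ b′ → ++⁺ a b ≋ ++⁺ a′ b′
    ++⁺-cong [] q = q
    ++⁺-cong (p ∷ ps) q = p ∷ ++⁺-cong ps q

    ++⁺-assoc : ∀ {X Y Z} (a : Row W X) (b : Row W Y) (c : Row W Z) →
                ++⁺ (++⁺ a b) c ≋ ++⁺ a (++⁺ b c)
    ++⁺-assoc [] b c = ≋-refl
    ++⁺-assoc (x ∷ a) b c = ↭.↭-refl ∷ ++⁺-assoc a b c

    ++⁺-identityʳ : ∀ {X} (a : Row W X) → ++⁺ a [] ≋ a
    ++⁺-identityʳ [] = []
    ++⁺-identityʳ (x ∷ a) = ↭.↭-refl ∷ ++⁺-identityʳ a

    ++⁺-cancel : ∀ {X Y Y′} {a a′ : Row W X} {b : Row W Y} {b′ : Row W Y′} →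
                 ++⁺ a b ≋ ++⁺ a′ b′ → a ≋ a′ × b ≋ b′
    ++⁺-cancel {a = []} {[]} p = [] , p
    ++⁺-cancel {a = x ∷ a} {y ∷ a′} (p ∷ ps) with ++⁺-cancel {a = a} {a′} ps
    ... | q , r = p ∷ q , r

    ++⁻-++⁺ : ∀ {X Y} (a : Row W X) (b : Row W Y) → ++⁻ X (++⁺ a b) ≡ (a , b)
    ++⁻-++⁺ [] b = refl
    ++⁻-++⁺ (x ∷ a) b = cong (λ (a , b) → x ∷ a , b) (++⁻-++⁺ a b)

    ++⁻-cong : ∀ X {Y Y′} {v : Row W (X ++ Y)} {w : Row W (X ++ Y′)} → v ≋ w →
               proj₁ (++⁻ X v) ≋ proj₁ (++⁻ X w) × proj₂ (++⁻ X v) ≋ proj₂ (++⁻ X w)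
    ++⁻-cong [] p = [] , p
    ++⁻-cong (U ∷ X) (p ∷ ps) with ++⁻-cong X ps
    ... | q , r = p ∷ q , r

    data Split (X : Poly Sg) {Y : Poly Sg} : Row W (X ++ Y) → Set where
      ++⁺-split : (a : Row W X) (b : Row W Y) → Split X (++⁺ a b)

    split : ∀ X {Y} (v : Row W (X ++ Y)) → Split X v
    split [] v = ++⁺-split [] v
    split (U ∷ X) (x ∷ v) with split X v
    ... | ++⁺-split a b = ++⁺-split (x ∷ a) b

    infixl 6 _+ᵣ_

    0ᵣ : ∀ X → Row W X
    0ᵣ [] = []
    0ᵣ (U ∷ X) = [] ∷ 0ᵣ X

    _+ᵣ_ : ∀ {X} → Row W X → Row W X → Row W X
    [] +ᵣ [] = []
    (x ∷ v) +ᵣ (y ∷ w) = (x ++ y) ∷ (v +ᵣ w)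

    +ᵣ-cong : ∀ {X Y} {a b : Row W X} {a′ b′ : Row W Y} → a ≋ a′ → b ≋ b′ → a +ᵣ b ≋ a′ +ᵣ b′
    +ᵣ-cong [] [] = []
    +ᵣ-cong (p ∷ ps) (q ∷ qs) = ↭ₚ.++⁺ p q ∷ +ᵣ-cong ps qs

    +ᵣ-identityˡ : ∀ {X} (a : Row W X) → 0ᵣ X +ᵣ a ≡ a
    +ᵣ-identityˡ [] = refl
    +ᵣ-identityˡ (x ∷ a) = cong (x ∷_) (+ᵣ-identityˡ a)

    +ᵣ-assoc : ∀ {X} (a b c : Row W X) → (a +ᵣ b) +ᵣ c ≋ a +ᵣ (b +ᵣ c)
    +ᵣ-assoc [] [] [] = []
    +ᵣ-assoc (x ∷ a) (y ∷ b) (z ∷ c) = ↭.↭-reflexive (++-assoc x y z) ∷ +ᵣ-assoc a b c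

    +ᵣ-comm : ∀ {X} (a b : Row W X) → a +ᵣ b ≋ b +ᵣ a
    +ᵣ-comm [] [] = []
    +ᵣ-comm (x ∷ a) (y ∷ b) = ↭ₚ.++-comm x y ∷ +ᵣ-comm a b

    +ᵣ-interchange : ∀ {X} (a b c d : Row W X) → (a +ᵣ b) +ᵣ (c +ᵣ d) ≋ (a +ᵣ c) +ᵣ (b +ᵣ d)
    +ᵣ-interchange [] [] [] [] = []
    +ᵣ-interchange (x ∷ a) (y ∷ b) (z ∷ c) (u ∷ d) = ++-interchange⁺ x y z u ∷ +ᵣ-interchange a b c d

    +ᵣ-++⁺ : ∀ {X Y} (a c : Row W X) (b d : Row W Y) → ++⁺ a b +ᵣ ++⁺ c d ≡ ++⁺ (a +ᵣ c) (b +ᵣ d)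
    +ᵣ-++⁺ [] [] b d = refl
    +ᵣ-++⁺ (x ∷ a) (y ∷ c) b d = cong ((x ++ y) ∷_) (+ᵣ-++⁺ a c b d)

    0ᵣ-++ : ∀ X Y → 0ᵣ (X ++ Y) ≡ ++⁺ (0ᵣ X) (0ᵣ Y)
    0ᵣ-++ [] Y = refl
    0ᵣ-++ (U ∷ X) Y = cong ([] ∷_) (0ᵣ-++ X Y)

  ⟦_⟧ : ∀ {X Y} → Tape Sg X Y → ∀ {W} → Row W X → Row W Y
  ⟦ pid X ⟧ v = v
  ⟦ ⌈ c ⌉ ⟧ (x ∷ []) = map (_⨾ c) x ∷ []
  ⟦ σ⊕ X Y ⟧ v = let a , b = ++⁻ X v in ++⁺ b a
  ⟦ Δ X ⟧ v = ++⁺ v v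
  ⟦ ! X ⟧ v = []
  ⟦ ∇ X ⟧ v = let a , b = ++⁻ X v in a +ᵣ b
  ⟦ ¡ X ⟧ v = 0ᵣ X
  ⟦ t ⨾ₜ s ⟧ v = ⟦ s ⟧ (⟦ t ⟧ v)
  ⟦ _⊕_ {X} t s ⟧ v = let a , b = ++⁻ X v in ++⁺ (⟦ t ⟧ a) (⟦ s ⟧ b)

  ⟦⟧-cong : ∀ {X Y} (t : Tape Sg X Y) {W} {v w : Row W X} → v ≋ w → ⟦ t ⟧ v ≋ ⟦ t ⟧ w
  ⟦⟧-cong (pid X) p = p
  ⟦⟧-cong ⌈ c ⌉ {W} (p ∷ []) = ↭ₚ.map⁺ (DiagSetoid Sg W _) (λ e → ⨾-cong e ≈refl) p ∷ []
  ⟦⟧-cong (σ⊕ X Y) p = let pa , pb = ++⁻-cong X p in ++⁺-cong pb pa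
  ⟦⟧-cong (Δ X) p = ++⁺-cong p p
  ⟦⟧-cong (! X) p = []
  ⟦⟧-cong (∇ X) p = let pa , pb = ++⁻-cong X p in +ᵣ-cong pa pb
  ⟦⟧-cong (¡ X) p = ≋-refl
  ⟦⟧-cong (t ⨾ₜ s) p = ⟦⟧-cong s (⟦⟧-cong t p)
  ⟦⟧-cong (_⊕_ {X} t s) p = let pa , pb = ++⁻-cong X p in ++⁺-cong (⟦⟧-cong t pa) (⟦⟧-cong s pb)

  module _ {W : Word Sg} where

    ⟦σ⊕⟧-++⁺ : ∀ {X Y} (a : Row W X) (b : Row W Y) → ⟦ σ⊕ X Y ⟧ (++⁺ a b) ≡ ++⁺ b a
    ⟦σ⊕⟧-++⁺ a b rewrite ++⁻-++⁺ a b = refl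

    ⟦∇⟧-++⁺ : ∀ {X} (a b : Row W X) → ⟦ ∇ X ⟧ (++⁺ a b) ≡ a +ᵣ b
    ⟦∇⟧-++⁺ a b rewrite ++⁻-++⁺ a b = refl

    ⟦⊕⟧-++⁺ : ∀ {X Y X′ Y′} (t : Tape Sg X Y) (s : Tape Sg X′ Y′) (a : Row W X) (b : Row W X′) →
              ⟦ t ⊕ s ⟧ (++⁺ a b) ≡ ++⁺ (⟦ t ⟧ a) (⟦ s ⟧ b)
    ⟦⊕⟧-++⁺ t s a b rewrite ++⁻-++⁺ a b = refl

    ⟦castT⟧ : ∀ {X X′ Y Y′} (p : X ≡ X′) (q : Y ≡ Y′) (t : Tape Sg X Y) {v : Row W X′} {w : Row W X} →
              v ≋ w → ⟦ castT Sg p q t ⟧ v ≋ ⟦ t ⟧ w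
    ⟦castT⟧ refl refl t = ⟦⟧-cong t

    ⟦⟧-+ᵣ : ∀ {X Y} (t : Tape Sg X Y) (a b : Row W X) → ⟦ t ⟧ (a +ᵣ b) ≋ ⟦ t ⟧ a +ᵣ ⟦ t ⟧ b
    ⟦⟧-+ᵣ (pid X) a b = ≋-refl
    ⟦⟧-+ᵣ ⌈ c ⌉ (x ∷ []) (y ∷ []) = ↭.↭-reflexive (map-++ _ x y) ∷ []
    ⟦⟧-+ᵣ (σ⊕ X Y) a b with split X a | split X b
    ... | ++⁺-split a₁ a₂ | ++⁺-split b₁ b₂
      rewrite +ᵣ-++⁺ a₁ b₁ a₂ b₂ | ⟦σ⊕⟧-++⁺ (a₁ +ᵣ b₁) (a₂ +ᵣ b₂) | ⟦σ⊕⟧-++⁺ a₁ a₂ | ⟦σ⊕⟧-++⁺ b₁ b₂ =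
      ≋-reflexive (sym (+ᵣ-++⁺ a₂ b₂ a₁ b₁))
    ⟦⟧-+ᵣ (Δ X) a b = ≋-reflexive (sym (+ᵣ-++⁺ a b a b))
    ⟦⟧-+ᵣ (! X) a b = []
    ⟦⟧-+ᵣ (∇ X) a b with split X a | split X b
    ... | ++⁺-split a₁ a₂ | ++⁺-split b₁ b₂
      rewrite +ᵣ-++⁺ a₁ b₁ a₂ b₂ | ⟦∇⟧-++⁺ (a₁ +ᵣ b₁) (a₂ +ᵣ b₂) | ⟦∇⟧-++⁺ a₁ a₂ | ⟦∇⟧-++⁺ b₁ b₂ =
      +ᵣ-interchange a₁ b₁ a₂ b₂
    ⟦⟧-+ᵣ (¡ X) a b = ≋-reflexive (sym (+ᵣ-identityˡ (0ᵣ X)))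
    ⟦⟧-+ᵣ (t ⨾ₜ s) a b = ≋-trans (⟦⟧-cong s (⟦⟧-+ᵣ t a b)) (⟦⟧-+ᵣ s (⟦ t ⟧ a) (⟦ t ⟧ b))
    ⟦⟧-+ᵣ (_⊕_ {X} t s) a b with split X a | split X b
    ... | ++⁺-split a₁ a₂ | ++⁺-split b₁ b₂
      rewrite +ᵣ-++⁺ a₁ b₁ a₂ b₂ | ⟦⊕⟧-++⁺ t s (a₁ +ᵣ b₁) (a₂ +ᵣ b₂) | ⟦⊕⟧-++⁺ t s a₁ a₂ | ⟦⊕⟧-++⁺ t s b₁ b₂ =
      ≋-trans (++⁺-cong (⟦⟧-+ᵣ t a₁ b₁) (⟦⟧-+ᵣ s a₂ b₂))
              (≋-reflexive (sym (+ᵣ-++⁺ (⟦ t ⟧ a₁) (⟦ t ⟧ b₁) (⟦ s ⟧ a₂) (⟦ s ⟧ b₂))))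

    ⟦⟧-0ᵣ : ∀ {X Y} (t : Tape Sg X Y) → ⟦ t ⟧ (0ᵣ X) ≋ 0ᵣ {W} Y
    ⟦⟧-0ᵣ (pid X) = ≋-refl
    ⟦⟧-0ᵣ ⌈ c ⌉ = ≋-refl
    ⟦⟧-0ᵣ (σ⊕ X Y) rewrite 0ᵣ-++ {W} X Y | ⟦σ⊕⟧-++⁺ (0ᵣ {W} X) (0ᵣ Y) = ≋-reflexive (sym (0ᵣ-++ Y X))
    ⟦⟧-0ᵣ (Δ X) = ≋-reflexive (sym (0ᵣ-++ X X))
    ⟦⟧-0ᵣ (! X) = []
    ⟦⟧-0ᵣ (∇ X) rewrite 0ᵣ-++ {W} X X | ⟦∇⟧-++⁺ (0ᵣ {W} X) (0ᵣ X) = ≋-reflexive (+ᵣ-identityˡ (0ᵣ X))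
    ⟦⟧-0ᵣ (¡ X) = ≋-refl
    ⟦⟧-0ᵣ (t ⨾ₜ s) = ≋-trans (⟦⟧-cong s (⟦⟧-0ᵣ t)) (⟦⟧-0ᵣ s)
    ⟦⟧-0ᵣ (_⊕_ {X} {Y} {X′} {Y′} t s) rewrite 0ᵣ-++ {W} X X′ | ⟦⊕⟧-++⁺ t s (0ᵣ {W} X) (0ᵣ X′) =
      ≋-trans (++⁺-cong (⟦⟧-0ᵣ t) (⟦⟧-0ᵣ s)) (≋-reflexive (sym (0ᵣ-++ Y Y′)))

  module ≋-Reasoning {W : Word Sg} where

    infix  1 begin_
    infixr 2 _≋⟨_⟩_ _≋⟨_⟨_ _≡⟨_⟩_ _≡⟨_⟨_
    infix  3 _∎

    begin_ : ∀ {X Y} {u : Row W X} {v : Row W Y} → u ≋ v → u ≋ v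
    begin p = p

    _≋⟨_⟩_ : ∀ {X Y Z} (u : Row W X) {v : Row W Y} {w : Row W Z} → u ≋ v → v ≋ w → u ≋ w
    u ≋⟨ p ⟩ q = ≋-trans p q

    _≋⟨_⟨_ : ∀ {X Y Z} (u : Row W X) {v : Row W Y} {w : Row W Z} → v ≋ u → v ≋ w → u ≋ w
    u ≋⟨ p ⟨ q = ≋-trans (≋-sym p) q

    _≡⟨_⟩_ : ∀ {X Z} (u : Row W X) {v : Row W X} {w : Row W Z} → u ≡ v → v ≋ w → u ≋ w
    u ≡⟨ p ⟩ q = ≋-trans (≋-reflexive p) q

    _≡⟨_⟨_ : ∀ {X Z} (u : Row W X) {v : Row W X} {w : Row W Z} → v ≡ u → v ≋ w → u ≋ w
    u ≡⟨ p ⟨ q = ≋-trans (≋-reflexive (sym p)) q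

    _∎ : ∀ {X} (u : Row W X) → u ≋ u
    u ∎ = ≋-refl

  module _ {W : Word Sg} where
    open ≋-Reasoning

    agree⇒sound : ∀ {A B} (t s : Tape Sg A B) → (∀ v → ⟦ t ⟧ v ≋ ⟦ s ⟧ v) →
                  ∀ {v w : Row W A} → v ≋ w → ⟦ t ⟧ v ≋ ⟦ s ⟧ w
    agree⇒sound t s t≋s {v} p = ≋-trans (t≋s v) (⟦⟧-cong s p)

    ⟦⊕⟧-≋ : ∀ {X Y X′ Y′} (t : Tape Sg X Y) (s : Tape Sg X′ Y′)
              {a : Row W X} {b : Row W X′} {w : Row W (X ++ X′)} →
            w ≋ ++⁺ a b → ⟦ t ⊕ s ⟧ w ≋ ++⁺ (⟦ t ⟧ a) (⟦ s ⟧ b)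
    ⟦⊕⟧-≋ {X} t s {a} {b} {w} p with split X w
    ... | ++⁺-split a′ b′ rewrite ⟦⊕⟧-++⁺ t s a′ b′ =
      let pa , pb = ++⁺-cancel {a = a′} {a} p in ++⁺-cong (⟦⟧-cong t pa) (⟦⟧-cong s pb)

    ⟦∇⟧-≋ : ∀ {X} {a b : Row W X} {w : Row W (X ++ X)} → w ≋ ++⁺ a b → ⟦ ∇ X ⟧ w ≋ a +ᵣ b
    ⟦∇⟧-≋ {X} {a} {w = w} p with split X w
    ... | ++⁺-split a′ b′ rewrite ⟦∇⟧-++⁺ a′ b′ = let pa , pb = ++⁺-cancel {a = a′} {a} p in +ᵣ-cong pa pb

    ⟦middle-σ⊕⟧ : ∀ {A B C D} (a : Row W A) (b : Row W B) (c : Row W C) (d : Row W D)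
                    {u : Row W (A ++ ((B ++ C) ++ D))} → u ≋ ++⁺ a (++⁺ b (++⁺ c d)) →
                  ⟦ pid A ⊕ (σ⊕ B C ⊕ pid D) ⟧ u ≋ ++⁺ (++⁺ a c) (++⁺ b d)
    ⟦middle-σ⊕⟧ {A} {B} {C} {D} a b c d {u} p = begin
      ⟦ pid A ⊕ (σ⊕ B C ⊕ pid D) ⟧ u
        ≋⟨ ⟦⊕⟧-≋ (pid A) (σ⊕ B C ⊕ pid D) {a} {++⁺ (++⁺ b c) d}
             (≋-trans p (++⁺-cong (≋-refl {v = a}) (≋-sym (++⁺-assoc b c d)))) ⟩
      ++⁺ a (⟦ σ⊕ B C ⊕ pid D ⟧ (++⁺ (++⁺ b c) d))
        ≡⟨ cong (++⁺ a) (trans (⟦⊕⟧-++⁺ (σ⊕ B C) (pid D) (++⁺ b c) d) (cong (λ e → ++⁺ e d) (⟦σ⊕⟧-++⁺ b c))) ⟩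
      ++⁺ a (++⁺ (++⁺ c b) d)
        ≋⟨ ++⁺-cong (≋-refl {v = a}) (++⁺-assoc c b d) ⟩
      ++⁺ a (++⁺ c (++⁺ b d))
        ≋⟨ ++⁺-assoc a c (++⁺ b d) ⟨
      ++⁺ (++⁺ a c) (++⁺ b d) ∎

    sound-⊕-assoc : ∀ {A B C D E F} (f : Tape Sg A B) (g : Tape Sg C D) (h : Tape Sg E F)
                      {v : Row W ((A ++ C) ++ E)} {w : Row W (A ++ (C ++ E))} → v ≋ w →
                    ⟦ (f ⊕ g) ⊕ h ⟧ v ≋ ⟦ f ⊕ (g ⊕ h) ⟧ w
    sound-⊕-assoc {A} {C = C} f g h {v} {w} p with split (A ++ C) v
    ... | ++⁺-split ac e with split A ac
    ... | ++⁺-split a c = begin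
      ⟦ (f ⊕ g) ⊕ h ⟧ (++⁺ (++⁺ a c) e)
        ≡⟨ trans (⟦⊕⟧-++⁺ (f ⊕ g) h (++⁺ a c) e) (cong (λ x → ++⁺ x (⟦ h ⟧ e)) (⟦⊕⟧-++⁺ f g a c)) ⟩
      ++⁺ (++⁺ (⟦ f ⟧ a) (⟦ g ⟧ c)) (⟦ h ⟧ e)
        ≋⟨ ++⁺-assoc (⟦ f ⟧ a) (⟦ g ⟧ c) (⟦ h ⟧ e) ⟩
      ++⁺ (⟦ f ⟧ a) (++⁺ (⟦ g ⟧ c) (⟦ h ⟧ e))
        ≡⟨ cong (++⁺ (⟦ f ⟧ a)) (⟦⊕⟧-++⁺ g h c e) ⟨
      ++⁺ (⟦ f ⟧ a) (⟦ g ⊕ h ⟧ (++⁺ c e))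
        ≋⟨ ⟦⊕⟧-≋ f (g ⊕ h) (≋-trans (≋-sym p) (++⁺-assoc a c e)) ⟨
      ⟦ f ⊕ (g ⊕ h) ⟧ w ∎

    sound-⊕-unitʳ : ∀ {A B} (f : Tape Sg A B) {v : Row W (A ++ [])} {w : Row W A} → v ≋ w →
                    ⟦ f ⊕ pid [] ⟧ v ≋ ⟦ f ⟧ w
    sound-⊕-unitʳ {A} f {v} p with split A v
    ... | ++⁺-split a [] rewrite ⟦⊕⟧-++⁺ f (pid []) a [] =
      ≋-trans (++⁺-identityʳ (⟦ f ⟧ a)) (⟦⟧-cong f (≋-trans (≋-sym (++⁺-identityʳ a)) p))

    sound-⊕-id : ∀ X Y (v : Row W (X ++ Y)) → ⟦ pid X ⊕ pid Y ⟧ v ≋ ⟦ pid (X ++ Y) ⟧ v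
    sound-⊕-id X Y v with split X v
    ... | ++⁺-split a b rewrite ⟦⊕⟧-++⁺ (pid X) (pid Y) a b = ≋-refl

    sound-interchange : ∀ {A B C A′ B′ C′} (f : Tape Sg A B) (g : Tape Sg B C)
                          (f′ : Tape Sg A′ B′) (g′ : Tape Sg B′ C′) (v : Row W (A ++ A′)) →
                        ⟦ (f ⨾ₜ g) ⊕ (f′ ⨾ₜ g′) ⟧ v ≋ ⟦ (f ⊕ f′) ⨾ₜ (g ⊕ g′) ⟧ v
    sound-interchange {A} f g f′ g′ v with split A v
    ... | ++⁺-split a b rewrite ⟦⊕⟧-++⁺ (f ⨾ₜ g) (f′ ⨾ₜ g′) a b | ⟦⊕⟧-++⁺ f f′ a b
                              | ⟦⊕⟧-++⁺ g g′ (⟦ f ⟧ a) (⟦ f′ ⟧ b) = ≋-refl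

    sound-σ-inv : ∀ X Y (v : Row W (X ++ Y)) → ⟦ σ⊕ X Y ⨾ₜ σ⊕ Y X ⟧ v ≋ ⟦ pid (X ++ Y) ⟧ v
    sound-σ-inv X Y v with split X v
    ... | ++⁺-split a b rewrite ⟦σ⊕⟧-++⁺ a b | ⟦σ⊕⟧-++⁺ b a = ≋-refl

    sound-σ-nat : ∀ {A B C D} (f : Tape Sg A B) (g : Tape Sg C D) (v : Row W (A ++ C)) →
                  ⟦ (f ⊕ g) ⨾ₜ σ⊕ B D ⟧ v ≋ ⟦ σ⊕ A C ⨾ₜ (g ⊕ f) ⟧ v
    sound-σ-nat {A} f g v with split A v
    ... | ++⁺-split a b
      rewrite ⟦⊕⟧-++⁺ f g a b | ⟦σ⊕⟧-++⁺ (⟦ f ⟧ a) (⟦ g ⟧ b) | ⟦σ⊕⟧-++⁺ a b | ⟦⊕⟧-++⁺ g f b a = ≋-refl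

    sound-σ-hex : ∀ X Y Z {v : Row W (X ++ (Y ++ Z))} {w : Row W ((X ++ Y) ++ Z)} → v ≋ w →
                  ⟦ σ⊕ X (Y ++ Z) ⟧ v ≋
                  ⟦ (σ⊕ X Y ⊕ pid Z) ⨾ₜ castT Sg (sym (++-assoc Y X Z)) refl (pid Y ⊕ σ⊕ X Z) ⟧ w
    sound-σ-hex X Y Z {v} {w} p with split X v
    ... | ++⁺-split a bc with split Y bc
    ... | ++⁺-split b c = begin
      ⟦ σ⊕ X (Y ++ Z) ⟧ (++⁺ a (++⁺ b c))
        ≡⟨ ⟦σ⊕⟧-++⁺ a (++⁺ b c) ⟩
      ++⁺ (++⁺ b c) a
        ≋⟨ ++⁺-assoc b c a ⟩
      ++⁺ b (++⁺ c a)
        ≡⟨ trans (⟦⊕⟧-++⁺ (pid Y) (σ⊕ X Z) b (++⁺ a c)) (cong (++⁺ b) (⟦σ⊕⟧-++⁺ a c)) ⟨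
      ⟦ pid Y ⊕ σ⊕ X Z ⟧ (++⁺ b (++⁺ a c))
        ≋⟨ ⟦castT⟧ (sym (++-assoc Y X Z)) refl (pid Y ⊕ σ⊕ X Z) swapped ⟨
      ⟦ castT Sg (sym (++-assoc Y X Z)) refl (pid Y ⊕ σ⊕ X Z) ⟧ (⟦ σ⊕ X Y ⊕ pid Z ⟧ w) ∎
      where
      swapped : ⟦ σ⊕ X Y ⊕ pid Z ⟧ w ≋ ++⁺ b (++⁺ a c)
      swapped = begin
        ⟦ σ⊕ X Y ⊕ pid Z ⟧ w
          ≋⟨ ⟦⊕⟧-≋ (σ⊕ X Y) (pid Z) (≋-trans (≋-sym p) (≋-sym (++⁺-assoc a b c))) ⟩
        ++⁺ (⟦ σ⊕ X Y ⟧ (++⁺ a b)) c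
          ≡⟨ cong (λ x → ++⁺ x c) (⟦σ⊕⟧-++⁺ a b) ⟩
        ++⁺ (++⁺ b a) c
          ≋⟨ ++⁺-assoc b a c ⟩
        ++⁺ b (++⁺ a c) ∎

    sound-σ-unit : ∀ X {v : Row W (X ++ [])} {w : Row W X} → v ≋ w → ⟦ σ⊕ X [] ⟧ v ≋ ⟦ pid X ⟧ w
    sound-σ-unit X {v} p with split X v
    ... | ++⁺-split a [] rewrite ⟦σ⊕⟧-++⁺ a [] = ≋-trans (≋-sym (++⁺-identityʳ a)) p

    sound-∇-assoc : ∀ X {v : Row W ((X ++ X) ++ X)} {w : Row W (X ++ (X ++ X))} → v ≋ w →
                    ⟦ (∇ X ⊕ pid X) ⨾ₜ ∇ X ⟧ v ≋ ⟦ (pid X ⊕ ∇ X) ⨾ₜ ∇ X ⟧ w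
    sound-∇-assoc X {v} {w} p with split (X ++ X) v
    ... | ++⁺-split ab c with split X ab
    ... | ++⁺-split a b rewrite ⟦⊕⟧-++⁺ (∇ X) (pid X) (++⁺ a b) c | ⟦∇⟧-++⁺ a b | ⟦∇⟧-++⁺ (a +ᵣ b) c =
      ≋-trans (+ᵣ-assoc a b c) (≋-sym (⟦∇⟧-≋ added))
      where
      added : ⟦ pid X ⊕ ∇ X ⟧ w ≋ ++⁺ a (b +ᵣ c)
      added = ≋-trans (⟦⊕⟧-≋ (pid X) (∇ X) (≋-trans (≋-sym p) (++⁺-assoc a b c)))
                      (≋-reflexive (cong (++⁺ a) (⟦∇⟧-++⁺ b c)))

    sound-∇-unit : ∀ X (v : Row W X) → ⟦ (¡ X ⊕ pid X) ⨾ₜ ∇ X ⟧ v ≋ ⟦ pid X ⟧ v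
    sound-∇-unit X v rewrite ⟦∇⟧-++⁺ (0ᵣ X) v | +ᵣ-identityˡ v = ≋-refl

    sound-∇-comm : ∀ X (v : Row W (X ++ X)) → ⟦ σ⊕ X X ⨾ₜ ∇ X ⟧ v ≋ ⟦ ∇ X ⟧ v
    sound-∇-comm X v with split X v
    ... | ++⁺-split a b rewrite ⟦σ⊕⟧-++⁺ a b | ⟦∇⟧-++⁺ b a | ⟦∇⟧-++⁺ a b = +ᵣ-comm b a

    sound-Δ-assoc : ∀ X {v w : Row W X} → v ≋ w → ⟦ Δ X ⨾ₜ (Δ X ⊕ pid X) ⟧ v ≋ ⟦ Δ X ⨾ₜ (pid X ⊕ Δ X) ⟧ w
    sound-Δ-assoc X {v} {w} p rewrite ⟦⊕⟧-++⁺ (Δ X) (pid X) v v | ⟦⊕⟧-++⁺ (pid X) (Δ X) w w =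
      ≋-trans (++⁺-assoc v v v) (++⁺-cong p (++⁺-cong p p))

    sound-Δ-unit : ∀ X (v : Row W X) → ⟦ Δ X ⨾ₜ (! X ⊕ pid X) ⟧ v ≋ ⟦ pid X ⟧ v
    sound-Δ-unit X v rewrite ⟦⊕⟧-++⁺ (! X) (pid X) v v = ≋-refl

    sound-Δ-comm : ∀ X (v : Row W X) → ⟦ Δ X ⨾ₜ σ⊕ X X ⟧ v ≋ ⟦ Δ X ⟧ v
    sound-Δ-comm X v rewrite ⟦σ⊕⟧-++⁺ v v = ≋-refl

    sound-∇-nat : ∀ {X Y} (t : Tape Sg X Y) (v : Row W (X ++ X)) → ⟦ ∇ X ⨾ₜ t ⟧ v ≋ ⟦ (t ⊕ t) ⨾ₜ ∇ Y ⟧ v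
    sound-∇-nat {X} t v with split X v
    ... | ++⁺-split a b rewrite ⟦∇⟧-++⁺ a b | ⟦⊕⟧-++⁺ t t a b | ⟦∇⟧-++⁺ (⟦ t ⟧ a) (⟦ t ⟧ b) = ⟦⟧-+ᵣ t a b

    sound-Δ-nat : ∀ {X Y} (t : Tape Sg X Y) (v : Row W X) → ⟦ t ⨾ₜ Δ Y ⟧ v ≋ ⟦ Δ X ⨾ₜ (t ⊕ t) ⟧ v
    sound-Δ-nat t v rewrite ⟦⊕⟧-++⁺ t t v v = ≋-refl

    sound-∇-⊕ : ∀ X Y {v : Row W ((X ++ Y) ++ (X ++ Y))} {w : Row W (X ++ ((Y ++ X) ++ Y))} → v ≋ w →
                ⟦ ∇ (X ++ Y) ⟧ v ≋
                ⟦ (pid X ⊕ (σ⊕ Y X ⊕ pid Y)) ⨾ₜ castT Sg (sym (mid-eq Sg X Y)) refl (∇ X ⊕ ∇ Y) ⟧ w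
    sound-∇-⊕ X Y {v} {w} p with split (X ++ Y) v
    ... | ++⁺-split ab cd with split X ab | split X cd
    ... | ++⁺-split a b | ++⁺-split c d = begin
      ⟦ ∇ (X ++ Y) ⟧ (++⁺ (++⁺ a b) (++⁺ c d))
        ≡⟨ trans (⟦∇⟧-++⁺ (++⁺ a b) (++⁺ c d)) (+ᵣ-++⁺ a c b d) ⟩
      ++⁺ (a +ᵣ c) (b +ᵣ d)
        ≡⟨ trans (⟦⊕⟧-++⁺ (∇ X) (∇ Y) (++⁺ a c) (++⁺ b d)) (cong₂ ++⁺ (⟦∇⟧-++⁺ a c) (⟦∇⟧-++⁺ b d)) ⟨
      ⟦ ∇ X ⊕ ∇ Y ⟧ (++⁺ (++⁺ a c) (++⁺ b d))
        ≋⟨ ⟦castT⟧ (sym (mid-eq Sg X Y)) refl (∇ X ⊕ ∇ Y) (⟦middle-σ⊕⟧ a b c d w≋) ⟨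
      ⟦ castT Sg (sym (mid-eq Sg X Y)) refl (∇ X ⊕ ∇ Y) ⟧ (⟦ pid X ⊕ (σ⊕ Y X ⊕ pid Y) ⟧ w) ∎
      where
      w≋ : w ≋ ++⁺ a (++⁺ b (++⁺ c d))
      w≋ = ≋-trans (≋-sym p) (++⁺-assoc a b (++⁺ c d))

    sound-Δ-⊕ : ∀ X Y {v w : Row W (X ++ Y)} → v ≋ w →
                ⟦ Δ (X ++ Y) ⟧ v ≋
                ⟦ castT Sg refl (sym (mid-eq Sg X Y)) (Δ X ⊕ Δ Y) ⨾ₜ (pid X ⊕ (σ⊕ X Y ⊕ pid Y)) ⟧ w
    sound-Δ-⊕ X Y {v} {w} p with split X v
    ... | ++⁺-split a b = ≋-sym (⟦middle-σ⊕⟧ a a b b copied)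
      where
      copied : ⟦ castT Sg refl (sym (mid-eq Sg X Y)) (Δ X ⊕ Δ Y) ⟧ w ≋ ++⁺ a (++⁺ a (++⁺ b b))
      copied = begin
        ⟦ castT Sg refl (sym (mid-eq Sg X Y)) (Δ X ⊕ Δ Y) ⟧ w
          ≋⟨ ⟦castT⟧ refl (sym (mid-eq Sg X Y)) (Δ X ⊕ Δ Y) (≋-sym p) ⟩
        ⟦ Δ X ⊕ Δ Y ⟧ (++⁺ a b)
          ≡⟨ ⟦⊕⟧-++⁺ (Δ X) (Δ Y) a b ⟩
        ++⁺ (++⁺ a a) (++⁺ b b)
          ≋⟨ ++⁺-assoc a a (++⁺ b b) ⟩
        ++⁺ a (++⁺ a (++⁺ b b)) ∎

  ≈ᴰ-indices : ∀ {A B C D} {c : Diag Sg A B} {d : Diag Sg C D} → c ≈ᴰ d → A ≡ C × B ≡ D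
  ≈ᴰ-indices ≈refl = refl , refl
  ≈ᴰ-indices (≈sym e) with ≈ᴰ-indices e
  ... | p , q = sym p , sym q
  ≈ᴰ-indices (≈trans e e′) with ≈ᴰ-indices e | ≈ᴰ-indices e′
  ... | p , q | p′ , q′ = trans p p′ , trans q q′
  ≈ᴰ-indices (⨾-cong e e′) = proj₁ (≈ᴰ-indices e) , proj₂ (≈ᴰ-indices e′)
  ≈ᴰ-indices (⊗-cong e e′) =
    cong₂ _++_ (proj₁ (≈ᴰ-indices e)) (proj₁ (≈ᴰ-indices e′)) ,
    cong₂ _++_ (proj₂ (≈ᴰ-indices e)) (proj₂ (≈ᴰ-indices e′))
  ≈ᴰ-indices (idˡ f) = refl , refl
  ≈ᴰ-indices (idʳ f) = refl , refl
  ≈ᴰ-indices (assoc f g h) = refl , refl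
  ≈ᴰ-indices (⊗-assoc {A} {B} {C} {D} {E} {F} f g h) = ++-assoc A C E , ++-assoc B D F
  ≈ᴰ-indices (⊗-unitˡ f) = refl , refl
  ≈ᴰ-indices (⊗-unitʳ {A} {B} f) = ++-identityʳ A , ++-identityʳ B
  ≈ᴰ-indices (⊗-id U V) = refl , refl
  ≈ᴰ-indices (interchange f g f′ g′) = refl , refl
  ≈ᴰ-indices (σ-inv U V) = refl , refl
  ≈ᴰ-indices (σ-nat f g) = refl , refl
  ≈ᴰ-indices (σ-hex U V W) = sym (++-assoc U V W) , ++-assoc V W U
  ≈ᴰ-indices (σ-unit U) = ++-identityʳ U , refl

  ≈ₜ-indices : ∀ {A B C D} {t : Tape Sg A B} {s : Tape Sg C D} → t ≈ₜ s → A ≡ C × B ≡ D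
  ≈ₜ-indices ≈refl = refl , refl
  ≈ₜ-indices (≈sym e) with ≈ₜ-indices e
  ... | p , q = sym p , sym q
  ≈ₜ-indices (≈trans e e′) with ≈ₜ-indices e | ≈ₜ-indices e′
  ... | p , q | p′ , q′ = trans p p′ , trans q q′
  ≈ₜ-indices (⨾-cong e e′) = proj₁ (≈ₜ-indices e) , proj₂ (≈ₜ-indices e′)
  ≈ₜ-indices (⊕-cong e e′) =
    cong₂ _++_ (proj₁ (≈ₜ-indices e)) (proj₁ (≈ₜ-indices e′)) ,
    cong₂ _++_ (proj₂ (≈ₜ-indices e)) (proj₂ (≈ₜ-indices e′))
  ≈ₜ-indices (⌈⌉-cong e) = cong [_] (proj₁ (≈ᴰ-indices e)) , cong [_] (proj₂ (≈ᴰ-indices e))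
  ≈ₜ-indices (⌈id⌉ U) = refl , refl
  ≈ₜ-indices (⌈⨾⌉ c d) = refl , refl
  ≈ₜ-indices (idˡ f) = refl , refl
  ≈ₜ-indices (idʳ f) = refl , refl
  ≈ₜ-indices (assoc f g h) = refl , refl
  ≈ₜ-indices (⊕-assoc {A} {B} {C} {D} {E} {F} f g h) = ++-assoc A C E , ++-assoc B D F
  ≈ₜ-indices (⊕-unitˡ f) = refl , refl
  ≈ₜ-indices (⊕-unitʳ {A} {B} f) = ++-identityʳ A , ++-identityʳ B
  ≈ₜ-indices (⊕-id X Y) = refl , refl
  ≈ₜ-indices (interchange f g f′ g′) = refl , refl
  ≈ₜ-indices (σ-inv X Y) = refl , refl
  ≈ₜ-indices (σ-nat f g) = refl , refl
  ≈ₜ-indices (σ-hex X Y Z) = sym (++-assoc X Y Z) , ++-assoc Y Z X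
  ≈ₜ-indices (σ-unit X) = ++-identityʳ X , refl
  ≈ₜ-indices (∇-assoc X) = ++-assoc X X X , refl
  ≈ₜ-indices (∇-unit X) = refl , refl
  ≈ₜ-indices (∇-comm X) = refl , refl
  ≈ₜ-indices (Δ-assoc X) = refl , ++-assoc X X X
  ≈ₜ-indices (Δ-unit X) = refl , refl
  ≈ₜ-indices (Δ-comm X) = refl , refl
  ≈ₜ-indices (∇-nat t) = refl , refl
  ≈ₜ-indices (¡-nat t) = refl , refl
  ≈ₜ-indices (Δ-nat t) = refl , refl
  ≈ₜ-indices (!-nat t) = refl , refl
  ≈ₜ-indices (∇-⊕ X Y) = ++-middle X Y , refl
  ≈ₜ-indices (Δ-⊕ X Y) = refl , ++-middle X Y
  ≈ₜ-indices (¡-⊕ X Y) = refl , refl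
  ≈ₜ-indices (!-⊕ X Y) = refl , refl
  ≈ₜ-indices ∇-0 = refl , refl
  ≈ₜ-indices Δ-0 = refl , refl
  ≈ₜ-indices ¡-0 = refl , refl
  ≈ₜ-indices !-0 = refl , refl

  map-⨾-cong : ∀ {W U V} {c d : Diag Sg U V} {x y : Hom⁺ Sg W U} → c ≈ᴰ d → x ≈⁺ y →
               map (_⨾ c) x ≈⁺ map (_⨾ d) y
  map-⨾-cong {W} {U} {V} {c} {d} {x} {y} c≈d x≈y =
    ↭.↭-trans (↭ₚ.map⁺ (DiagSetoid Sg W V) (λ e → ⨾-cong e ≈refl) x≈y) (pointwise y)
    where
    pointwise : ∀ y → map (_⨾ c) y ≈⁺ map (_⨾ d) y
    pointwise [] = ↭.↭-refl {W} {V}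
    pointwise (f ∷ y) = ↭.prep {W} {V} (⨾-cong ≈refl c≈d) (pointwise y)

  map-⨾-identityʳ : ∀ {W U} (x : Hom⁺ Sg W U) → map (_⨾ id U) x ≈⁺ x
  map-⨾-identityʳ {W} {U} [] = ↭.↭-refl {W} {U}
  map-⨾-identityʳ {W} {U} (f ∷ x) = ↭.prep {W} {U} (idʳ f) (map-⨾-identityʳ x)

  map-⨾-assoc : ∀ {W U V Z} (c : Diag Sg U V) (d : Diag Sg V Z) (x : Hom⁺ Sg W U) →
                map (_⨾ (c ⨾ d)) x ≈⁺ map (_⨾ d) (map (_⨾ c) x)
  map-⨾-assoc {W} {Z = Z} c d [] = ↭.↭-refl {W} {Z}
  map-⨾-assoc {W} {Z = Z} c d (f ∷ x) = ↭.prep {W} {Z} (≈sym (assoc f c d)) (map-⨾-assoc c d x)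

  ⟦⟧-sound : ∀ {A B C E} {t : Tape Sg A B} {s : Tape Sg C E} → t ≈ₜ s →
             ∀ {W} {v : Row W A} {w : Row W C} → v ≋ w → ⟦ t ⟧ v ≋ ⟦ s ⟧ w
  ⟦⟧-sound {t = t} ≈refl p = ⟦⟧-cong t p
  ⟦⟧-sound (≈sym e) p = ≋-sym (⟦⟧-sound e (≋-sym p))
  ⟦⟧-sound (≈trans e e′) p with ≈ₜ-indices e′
  ... | refl , _ = ≋-trans (⟦⟧-sound e p) (⟦⟧-sound e′ ≋-refl)
  ⟦⟧-sound (⨾-cong e e′) p = ⟦⟧-sound e′ (⟦⟧-sound e p)
  ⟦⟧-sound (⊕-cong {A = A} {f = f} {g} {f′} {g′} e e′) {v = v} p with ≈ₜ-indices e | ≈ₜ-indices e′ | split A v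
  ... | refl , _ | refl , _ | ++⁺-split a c = begin
    ⟦ f ⊕ g ⟧ (++⁺ a c)        ≡⟨ ⟦⊕⟧-++⁺ f g a c ⟩
    ++⁺ (⟦ f ⟧ a) (⟦ g ⟧ c)    ≋⟨ ++⁺-cong (⟦⟧-sound e ≋-refl) (⟦⟧-sound e′ ≋-refl) ⟩
    ++⁺ (⟦ f′ ⟧ a) (⟦ g′ ⟧ c)  ≋⟨ ⟦⊕⟧-≋ f′ g′ (≋-sym p) ⟨
    ⟦ f′ ⊕ g′ ⟧ _ ∎
    where open ≋-Reasoning
  ⟦⟧-sound (⌈⌉-cong e) (p ∷ []) with ≈ᴰ-indices e
  ... | _ , refl = map-⨾-cong e p ∷ []
  ⟦⟧-sound (⌈id⌉ U) {v = x ∷ []} (p ∷ []) = ↭.↭-trans (map-⨾-identityʳ x) p ∷ []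
  ⟦⟧-sound (⌈⨾⌉ c d) {v = x ∷ []} p = ≋-trans (map-⨾-assoc c d x ∷ []) (⟦⟧-cong (⌈ c ⌉ ⨾ₜ ⌈ d ⌉) p)
  ⟦⟧-sound (idˡ f) p = ⟦⟧-cong f p
  ⟦⟧-sound (idʳ f) p = ⟦⟧-cong f p
  ⟦⟧-sound (assoc f g h) p = ⟦⟧-cong ((f ⨾ₜ g) ⨾ₜ h) p
  ⟦⟧-sound (⊕-assoc f g h) p = sound-⊕-assoc f g h p
  ⟦⟧-sound (⊕-unitˡ f) p = ⟦⟧-cong f p
  ⟦⟧-sound (⊕-unitʳ f) p = sound-⊕-unitʳ f p
  ⟦⟧-sound {t = lhs} {s = rhs} (⊕-id X Y) = agree⇒sound lhs rhs (sound-⊕-id X Y)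
  ⟦⟧-sound {t = lhs} {s = rhs} (interchange f g f′ g′) = agree⇒sound lhs rhs (sound-interchange f g f′ g′)
  ⟦⟧-sound {t = lhs} {s = rhs} (σ-inv X Y) = agree⇒sound lhs rhs (sound-σ-inv X Y)
  ⟦⟧-sound {t = lhs} {s = rhs} (σ-nat f g) = agree⇒sound lhs rhs (sound-σ-nat f g)
  ⟦⟧-sound (σ-hex X Y Z) p = sound-σ-hex X Y Z p
  ⟦⟧-sound (σ-unit X) p = sound-σ-unit X p
  ⟦⟧-sound (∇-assoc X) p = sound-∇-assoc X p
  ⟦⟧-sound {t = lhs} {s = rhs} (∇-unit X) = agree⇒sound lhs rhs (sound-∇-unit X)
  ⟦⟧-sound {t = lhs} {s = rhs} (∇-comm X) = agree⇒sound lhs rhs (sound-∇-comm X)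
  ⟦⟧-sound (Δ-assoc X) p = sound-Δ-assoc X p
  ⟦⟧-sound {t = lhs} {s = rhs} (Δ-unit X) = agree⇒sound lhs rhs (sound-Δ-unit X)
  ⟦⟧-sound {t = lhs} {s = rhs} (Δ-comm X) = agree⇒sound lhs rhs (sound-Δ-comm X)
  ⟦⟧-sound {t = lhs} {s = rhs} (∇-nat t) = agree⇒sound lhs rhs (sound-∇-nat t)
  ⟦⟧-sound (¡-nat t) [] = ⟦⟧-0ᵣ t
  ⟦⟧-sound {t = lhs} {s = rhs} (Δ-nat t) = agree⇒sound lhs rhs (sound-Δ-nat t)
  ⟦⟧-sound (!-nat t) p = []
  ⟦⟧-sound (∇-⊕ X Y) p = sound-∇-⊕ X Y p
  ⟦⟧-sound (Δ-⊕ X Y) p = sound-Δ-⊕ X Y p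
  ⟦⟧-sound (¡-⊕ X Y) [] = ≋-reflexive (0ᵣ-++ X Y)
  ⟦⟧-sound (!-⊕ X Y) p = []
  ⟦⟧-sound ∇-0 [] = []
  ⟦⟧-sound Δ-0 [] = []
  ⟦⟧-sound ¡-0 [] = []
  ⟦⟧-sound !-0 [] = []

  -- The clauses of L U, R U and the identity, up to the reindexing M of objects;
  -- for these three maps every law holds by refl.
  record TapeMap : Set where
    field
      M    : Poly Sg → Poly Sg
      M-[] : M [] ≡ []
      M-++ : ∀ X Y → M (X ++ Y) ≡ M X ++ M Y
      Φ    : ∀ {X Y} → Tape Sg X Y → Tape Sg (M X) (M Y)
      Φ-pid : ∀ X → Φ (pid X) ≡ pid (M X)
      Φ-σ⊕  : ∀ X Y → Φ (σ⊕ X Y) ≡ castT Sg (sym (M-++ X Y)) (sym (M-++ Y X)) (σ⊕ (M X) (M Y))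
      Φ-Δ   : ∀ X → Φ (Δ X) ≡ castT Sg refl (sym (M-++ X X)) (Δ (M X))
      Φ-!   : ∀ X → Φ (! X) ≡ castT Sg refl (sym M-[]) (! (M X))
      Φ-∇   : ∀ X → Φ (∇ X) ≡ castT Sg (sym (M-++ X X)) refl (∇ (M X))
      Φ-¡   : ∀ X → Φ (¡ X) ≡ castT Sg (sym M-[]) refl (¡ (M X))
      Φ-⨾   : ∀ {X Y Z} (t : Tape Sg X Y) (s : Tape Sg Y Z) → Φ (t ⨾ₜ s) ≡ Φ t ⨾ₜ Φ s
      Φ-⊕   : ∀ {X Y X′ Y′} (t : Tape Sg X Y) (s : Tape Sg X′ Y′) →
              Φ (t ⊕ s) ≡ castT Sg (sym (M-++ X X′)) (sym (M-++ Y Y′)) (Φ t ⊕ Φ s)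

  record RowMap (W W′ : Word Sg) (M : Poly Sg → Poly Sg) : Set where
    field
      ρ     : ∀ {X} → Row W X → Row W′ (M X)
      ρ-[]  : ρ [] ≋ ([] {P = Hom⁺ Sg W′})
      ρ-++⁺ : ∀ {X Y} (a : Row W X) (b : Row W Y) → ρ (++⁺ a b) ≋ ++⁺ (ρ a) (ρ b)
      ρ-0ᵣ  : ∀ X → ρ (0ᵣ X) ≋ 0ᵣ (M X)
      ρ-+ᵣ  : ∀ {X} (a b : Row W X) → ρ (a +ᵣ b) ≋ ρ a +ᵣ ρ b

  module _ (tm : TapeMap) {W W′ : Word Sg} (rm : RowMap W W′ (TapeMap.M tm)) where
    open TapeMap tm
    open RowMap rm

    ⟦Φ⟧-ρ : (∀ {U V} (c : Diag Sg U V) (x : Hom⁺ Sg W U) → ⟦ Φ ⌈ c ⌉ ⟧ (ρ (x ∷ [])) ≋ ρ (map (_⨾ c) x ∷ [])) →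
            ∀ {X Y} (t : Tape Sg X Y) (v : Row W X) → ⟦ Φ t ⟧ (ρ v) ≋ ρ (⟦ t ⟧ v)
    ⟦Φ⟧-ρ ⟦Φ⌈⌉⟧-ρ = go
      where
      go : ∀ {X Y} (t : Tape Sg X Y) (v : Row W X) → ⟦ Φ t ⟧ (ρ v) ≋ ρ (⟦ t ⟧ v)
      go (pid X) v rewrite Φ-pid X = ≋-refl
      go ⌈ c ⌉ (x ∷ []) = ⟦Φ⌈⌉⟧-ρ c x
      go (σ⊕ X Y) v rewrite Φ-σ⊕ X Y with split X v
      ... | ++⁺-split a b rewrite ⟦σ⊕⟧-++⁺ a b =
        ≋-trans (⟦castT⟧ (sym (M-++ X Y)) (sym (M-++ Y X)) (σ⊕ (M X) (M Y)) (ρ-++⁺ a b))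
                (≋-trans (≋-reflexive (⟦σ⊕⟧-++⁺ (ρ a) (ρ b))) (≋-sym (ρ-++⁺ b a)))
      go (Δ X) v rewrite Φ-Δ X =
        ≋-trans (⟦castT⟧ refl (sym (M-++ X X)) (Δ (M X)) (≋-refl {v = ρ v})) (≋-sym (ρ-++⁺ v v))
      go (! X) v rewrite Φ-! X = ≋-trans (⟦castT⟧ refl (sym M-[]) (! (M X)) (≋-refl {v = ρ v})) (≋-sym ρ-[])
      go (∇ X) v rewrite Φ-∇ X with split X v
      ... | ++⁺-split a b rewrite ⟦∇⟧-++⁺ a b =
        ≋-trans (⟦castT⟧ (sym (M-++ X X)) refl (∇ (M X)) (ρ-++⁺ a b))
                (≋-trans (≋-reflexive (⟦∇⟧-++⁺ (ρ a) (ρ b))) (≋-sym (ρ-+ᵣ a b)))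
      go (¡ X) [] rewrite Φ-¡ X = ≋-trans (⟦castT⟧ (sym M-[]) refl (¡ (M X)) ρ-[]) (≋-sym (ρ-0ᵣ X))
      go (t ⨾ₜ s) v rewrite Φ-⨾ t s = ≋-trans (⟦⟧-cong (Φ s) (go t v)) (go s (⟦ t ⟧ v))
      go (_⊕_ {X} {Y} {X′} {Y′} t s) v rewrite Φ-⊕ t s with split X v
      ... | ++⁺-split a b rewrite ⟦⊕⟧-++⁺ t s a b =
        ≋-trans (⟦castT⟧ (sym (M-++ X X′)) (sym (M-++ Y Y′)) (Φ t ⊕ Φ s) (ρ-++⁺ a b))
          (≋-trans (≋-reflexive (⟦⊕⟧-++⁺ (Φ t) (Φ s) (ρ a) (ρ b)))
            (≋-trans (++⁺-cong (go t a) (go s b)) (≋-sym (ρ-++⁺ (⟦ t ⟧ a) (⟦ s ⟧ b)))))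

  identityTapeMap : TapeMap
  identityTapeMap = record
    { M = λ X → X ; M-[] = refl ; M-++ = λ _ _ → refl ; Φ = λ t → t
    ; Φ-pid = λ _ → refl ; Φ-σ⊕ = λ _ _ → refl ; Φ-Δ = λ _ → refl ; Φ-! = λ _ → refl
    ; Φ-∇ = λ _ → refl ; Φ-¡ = λ _ → refl ; Φ-⨾ = λ _ _ → refl ; Φ-⊕ = λ _ _ → refl }

  L-tapeMap : Word Sg → TapeMap
  L-tapeMap U = record
    { M = _·_ Sg U ; M-[] = refl ; M-++ = map-++ (U ++_) ; Φ = L Sg U
    ; Φ-pid = λ _ → refl ; Φ-σ⊕ = λ _ _ → refl ; Φ-Δ = λ _ → refl ; Φ-! = λ _ → refl
    ; Φ-∇ = λ _ → refl ; Φ-¡ = λ _ → refl ; Φ-⨾ = λ _ _ → refl ; Φ-⊕ = λ _ _ → refl }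

  R-tapeMap : Word Sg → TapeMap
  R-tapeMap V = record
    { M = λ X → _∙_ Sg X V ; M-[] = refl ; M-++ = map-++ (_++ V) ; Φ = R Sg V
    ; Φ-pid = λ _ → refl ; Φ-σ⊕ = λ _ _ → refl ; Φ-Δ = λ _ → refl ; Φ-! = λ _ → refl
    ; Φ-∇ = λ _ → refl ; Φ-¡ = λ _ → refl ; Φ-⨾ = λ _ _ → refl ; Φ-⊕ = λ _ _ → refl }

  infixr 7 _⨾ᵣ_ _⊗ᵣ_
  infixl 7 _ᵣ⊗_

  _⨾ᵣ_ : ∀ {W′ W X} → Hom⁺ Sg W′ W → Row W X → Row W′ X
  g ⨾ᵣ [] = []
  g ⨾ᵣ (x ∷ v) = (g ⨾⁺ x) ∷ (g ⨾ᵣ v)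

  _⊗ᵣ_ : ∀ {W′ U W X} → Hom⁺ Sg W′ U → Row W X → Row (W′ ++ W) (_·_ Sg U X)
  g ⊗ᵣ [] = []
  g ⊗ᵣ (x ∷ v) = (g ⊗⁺ x) ∷ (g ⊗ᵣ v)

  _ᵣ⊗_ : ∀ {W W″ V X} → Row W X → Hom⁺ Sg W″ V → Row (W ++ W″) (_∙_ Sg X V)
  [] ᵣ⊗ h = []
  (x ∷ v) ᵣ⊗ h = (x ⊗⁺ h) ∷ (v ᵣ⊗ h)

  ⨾ᵣ-rowMap : ∀ {W′ W} → Hom⁺ Sg W′ W → RowMap W W′ (λ X → X)
  ⨾ᵣ-rowMap {W′} {W} g = record
    { ρ = g ⨾ᵣ_ ; ρ-[] = [] ; ρ-++⁺ = ⨾ᵣ-++⁺ ; ρ-0ᵣ = ⨾ᵣ-0ᵣ ; ρ-+ᵣ = ⨾ᵣ-+ᵣ }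
    where
    ⨾ᵣ-++⁺ : ∀ {X Y} (a : Row W X) (b : Row W Y) → g ⨾ᵣ ++⁺ a b ≋ ++⁺ (g ⨾ᵣ a) (g ⨾ᵣ b)
    ⨾ᵣ-++⁺ [] b = ≋-refl
    ⨾ᵣ-++⁺ (x ∷ a) b = ↭.↭-refl ∷ ⨾ᵣ-++⁺ a b
    ⨾ᵣ-0ᵣ : ∀ X → g ⨾ᵣ 0ᵣ X ≋ 0ᵣ X
    ⨾ᵣ-0ᵣ [] = []
    ⨾ᵣ-0ᵣ (U ∷ X) = ↭.↭-reflexive (cartesianProductWith-zeroʳ _⨾_ g) ∷ ⨾ᵣ-0ᵣ X
    ⨾ᵣ-+ᵣ : ∀ {X} (a b : Row W X) → g ⨾ᵣ (a +ᵣ b) ≋ g ⨾ᵣ a +ᵣ g ⨾ᵣ b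
    ⨾ᵣ-+ᵣ [] [] = []
    ⨾ᵣ-+ᵣ (x ∷ a) (y ∷ b) = cartesianProductWith-distribˡ-++⁺ _⨾_ g x y ∷ ⨾ᵣ-+ᵣ a b

  ⊗ᵣ-rowMap : ∀ {W′ U W} → Hom⁺ Sg W′ U → RowMap W (W′ ++ W) (_·_ Sg U)
  ⊗ᵣ-rowMap {W′} {U} {W} g = record
    { ρ = g ⊗ᵣ_ ; ρ-[] = [] ; ρ-++⁺ = ⊗ᵣ-++⁺ ; ρ-0ᵣ = ⊗ᵣ-0ᵣ ; ρ-+ᵣ = ⊗ᵣ-+ᵣ }
    where
    ⊗ᵣ-++⁺ : ∀ {X Y} (a : Row W X) (b : Row W Y) → g ⊗ᵣ ++⁺ a b ≋ ++⁺ (g ⊗ᵣ a) (g ⊗ᵣ b)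
    ⊗ᵣ-++⁺ [] b = ≋-refl
    ⊗ᵣ-++⁺ (x ∷ a) b = ↭.↭-refl ∷ ⊗ᵣ-++⁺ a b
    ⊗ᵣ-0ᵣ : ∀ X → g ⊗ᵣ 0ᵣ X ≋ 0ᵣ (_·_ Sg U X)
    ⊗ᵣ-0ᵣ [] = []
    ⊗ᵣ-0ᵣ (V ∷ X) = ↭.↭-reflexive (cartesianProductWith-zeroʳ _⊗_ g) ∷ ⊗ᵣ-0ᵣ X
    ⊗ᵣ-+ᵣ : ∀ {X} (a b : Row W X) → g ⊗ᵣ (a +ᵣ b) ≋ g ⊗ᵣ a +ᵣ g ⊗ᵣ b
    ⊗ᵣ-+ᵣ [] [] = []
    ⊗ᵣ-+ᵣ (x ∷ a) (y ∷ b) = cartesianProductWith-distribˡ-++⁺ _⊗_ g x y ∷ ⊗ᵣ-+ᵣ a b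

  ᵣ⊗-rowMap : ∀ {W″ V W} → Hom⁺ Sg W″ V → RowMap W (W ++ W″) (λ X → _∙_ Sg X V)
  ᵣ⊗-rowMap {W″} {V} {W} h = record
    { ρ = _ᵣ⊗ h ; ρ-[] = [] ; ρ-++⁺ = ᵣ⊗-++⁺ ; ρ-0ᵣ = ᵣ⊗-0ᵣ ; ρ-+ᵣ = ᵣ⊗-+ᵣ }
    where
    ᵣ⊗-++⁺ : ∀ {X Y} (a : Row W X) (b : Row W Y) → ++⁺ a b ᵣ⊗ h ≋ ++⁺ (a ᵣ⊗ h) (b ᵣ⊗ h)
    ᵣ⊗-++⁺ [] b = ≋-refl
    ᵣ⊗-++⁺ (x ∷ a) b = ↭.↭-refl ∷ ᵣ⊗-++⁺ a b
    ᵣ⊗-0ᵣ : ∀ X → 0ᵣ X ᵣ⊗ h ≋ 0ᵣ (_∙_ Sg X V)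
    ᵣ⊗-0ᵣ [] = []
    ᵣ⊗-0ᵣ (U ∷ X) = ↭.↭-refl ∷ ᵣ⊗-0ᵣ X
    ᵣ⊗-+ᵣ : ∀ {X} (a b : Row W X) → (a +ᵣ b) ᵣ⊗ h ≋ a ᵣ⊗ h +ᵣ b ᵣ⊗ h
    ᵣ⊗-+ᵣ [] [] = []
    ᵣ⊗-+ᵣ (x ∷ a) (y ∷ b) = ↭.↭-reflexive (cartesianProductWith-distribʳ-++ _⊗_ x y h) ∷ ᵣ⊗-+ᵣ a b

  ⟦⟧-⨾ᵣ : ∀ {W′ W X Y} (g : Hom⁺ Sg W′ W) (t : Tape Sg X Y) (v : Row W X) → ⟦ t ⟧ (g ⨾ᵣ v) ≋ g ⨾ᵣ ⟦ t ⟧ v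
  ⟦⟧-⨾ᵣ g = ⟦Φ⟧-ρ identityTapeMap (⨾ᵣ-rowMap g) λ c x →
    map-cartesianProductWithʳ _⨾_ _⨾_ (_⨾ c) (_⨾ c) (λ a f → assoc a f c) g x ∷ []

  ⟦L⟧-⊗ᵣ : ∀ {W′ U W X Y} (g : Hom⁺ Sg W′ U) (t : Tape Sg X Y) (v : Row W X) →
           ⟦ L Sg U t ⟧ (g ⊗ᵣ v) ≋ g ⊗ᵣ ⟦ t ⟧ v
  ⟦L⟧-⊗ᵣ {U = U} g = ⟦Φ⟧-ρ (L-tapeMap U) (⊗ᵣ-rowMap g) λ c x →
    map-cartesianProductWithʳ _⊗_ _⊗_ (_⨾ (id U ⊗ c)) (_⨾ c)
      (λ a f → ≈trans (≈sym (interchange a (id U) f c)) (⊗-cong (idʳ a) ≈refl)) g x ∷ []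

  ⟦R⟧-ᵣ⊗ : ∀ {W″ V W X Y} (h : Hom⁺ Sg W″ V) (t : Tape Sg X Y) (v : Row W X) →
           ⟦ R Sg V t ⟧ (v ᵣ⊗ h) ≋ ⟦ t ⟧ v ᵣ⊗ h
  ⟦R⟧-ᵣ⊗ {V = V} h = ⟦Φ⟧-ρ (R-tapeMap V) (ᵣ⊗-rowMap h) λ c x →
    map-cartesianProductWithˡ _⊗_ _⊗_ (_⨾ (c ⊗ id V)) (_⨾ c)
      (λ a f → ≈trans (≈sym (interchange a c f (id V))) (⊗-cong ≈refl (idʳ f))) x h ∷ []

  module ≈ₜ-Reasoning where

    infix  1 begin_
    infixr 2 _≈⟨_⟩_ _≈⟨_⟨_
    infix  3 _∎

    begin_ : ∀ {A B C D} {t : Tape Sg A B} {s : Tape Sg C D} → t ≈ₜ s → t ≈ₜ s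
    begin e = e

    _≈⟨_⟩_ : ∀ {A B C D E F} (t : Tape Sg A B) {s : Tape Sg C D} {r : Tape Sg E F} → t ≈ₜ s → s ≈ₜ r → t ≈ₜ r
    t ≈⟨ e ⟩ e′ = ≈trans e e′

    _≈⟨_⟨_ : ∀ {A B C D E F} (t : Tape Sg A B) {s : Tape Sg C D} {r : Tape Sg E F} → s ≈ₜ t → s ≈ₜ r → t ≈ₜ r
    t ≈⟨ e ⟨ e′ = ≈trans (≈sym e) e′

    _∎ : ∀ {A B} (t : Tape Sg A B) → t ≈ₜ t
    t ∎ = ≈refl

  module _ {S : Poly Sg} where
    open ≈ₜ-Reasoning

    infixl 6 _+ₜ_

    ⟨_,_⟩ : ∀ {A B} → Tape Sg S A → Tape Sg S B → Tape Sg S (A ++ B)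
    ⟨ p , q ⟩ = Δ S ⨾ₜ (p ⊕ q)

    0ₜ : ∀ A → Tape Sg S A
    0ₜ A = ! S ⨾ₜ ¡ A

    _+ₜ_ : ∀ {A} → Tape Sg S A → Tape Sg S A → Tape Sg S A
    _+ₜ_ {A} p q = ⟨ p , q ⟩ ⨾ₜ ∇ A

    ⟨⟩-cong : ∀ {A B A′ B′} {p : Tape Sg S A} {q : Tape Sg S B} {p′ : Tape Sg S A′} {q′ : Tape Sg S B′} →
              p ≈ₜ p′ → q ≈ₜ q′ → ⟨ p , q ⟩ ≈ₜ ⟨ p′ , q′ ⟩
    ⟨⟩-cong e e′ = ⨾-cong ≈refl (⊕-cong e e′)

    ⟨⟩-⨾ : ∀ {A B C D} (p : Tape Sg S A) (q : Tape Sg S B) (f : Tape Sg A C) (g : Tape Sg B D) →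
           ⟨ p , q ⟩ ⨾ₜ (f ⊕ g) ≈ₜ ⟨ p ⨾ₜ f , q ⨾ₜ g ⟩
    ⟨⟩-⨾ p q f g = ≈trans (assoc _ _ _) (⨾-cong ≈refl (≈sym (interchange p f q g)))

    ⟨⟩-!ˡ : ∀ {A} (q : Tape Sg S A) → ⟨ ! S , q ⟩ ≈ₜ q
    ⟨⟩-!ˡ q = begin
      ⟨ ! S , q ⟩                                 ≈⟨ ⟨⟩-cong (≈sym (idʳ (! S))) (≈sym (idˡ q)) ⟩
      Δ S ⨾ₜ ((! S ⨾ₜ pid []) ⊕ (pid S ⨾ₜ q))     ≈⟨ ⨾-cong ≈refl (interchange _ _ _ _) ⟩
      Δ S ⨾ₜ ((! S ⊕ pid S) ⨾ₜ (pid [] ⊕ q))      ≈⟨ assoc _ _ _ ⟨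
      (Δ S ⨾ₜ (! S ⊕ pid S)) ⨾ₜ (pid [] ⊕ q)      ≈⟨ ⨾-cong (Δ-unit S) ≈refl ⟩
      pid S ⨾ₜ (pid [] ⊕ q)                       ≈⟨ idˡ _ ⟩
      pid [] ⊕ q                                  ≈⟨ ⊕-unitˡ q ⟩
      q                                           ∎

    ⟨⟩-assoc : ∀ {A B C} (p : Tape Sg S A) (q : Tape Sg S B) (r : Tape Sg S C) →
               ⟨ p , ⟨ q , r ⟩ ⟩ ≈ₜ ⟨ ⟨ p , q ⟩ , r ⟩
    ⟨⟩-assoc p q r = begin
      Δ S ⨾ₜ (p ⊕ (Δ S ⨾ₜ (q ⊕ r)))                ≈⟨ ⨾-cong ≈refl (⊕-cong (≈sym (idˡ p)) ≈refl) ⟩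
      Δ S ⨾ₜ ((pid S ⨾ₜ p) ⊕ (Δ S ⨾ₜ (q ⊕ r)))     ≈⟨ ⨾-cong ≈refl (interchange _ _ _ _) ⟩
      Δ S ⨾ₜ ((pid S ⊕ Δ S) ⨾ₜ (p ⊕ (q ⊕ r)))      ≈⟨ assoc _ _ _ ⟨
      (Δ S ⨾ₜ (pid S ⊕ Δ S)) ⨾ₜ (p ⊕ (q ⊕ r))      ≈⟨ ⨾-cong (≈sym (Δ-assoc S)) (≈sym (⊕-assoc p q r)) ⟩
      (Δ S ⨾ₜ (Δ S ⊕ pid S)) ⨾ₜ ((p ⊕ q) ⊕ r)      ≈⟨ assoc _ _ _ ⟩
      Δ S ⨾ₜ ((Δ S ⊕ pid S) ⨾ₜ ((p ⊕ q) ⊕ r))      ≈⟨ ⨾-cong ≈refl (interchange _ _ _ _) ⟨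
      Δ S ⨾ₜ ((Δ S ⨾ₜ (p ⊕ q)) ⊕ (pid S ⨾ₜ r))     ≈⟨ ⨾-cong ≈refl (⊕-cong ≈refl (idˡ r)) ⟩
      ⟨ ⟨ p , q ⟩ , r ⟩                            ∎

    ⟨⟩-σ⊕ : ∀ {A B} (p : Tape Sg S A) (q : Tape Sg S B) → ⟨ p , q ⟩ ⨾ₜ σ⊕ A B ≈ₜ ⟨ q , p ⟩
    ⟨⟩-σ⊕ {A} {B} p q = begin
      (Δ S ⨾ₜ (p ⊕ q)) ⨾ₜ σ⊕ A B     ≈⟨ assoc _ _ _ ⟩
      Δ S ⨾ₜ ((p ⊕ q) ⨾ₜ σ⊕ A B)     ≈⟨ ⨾-cong ≈refl (σ-nat p q) ⟩
      Δ S ⨾ₜ (σ⊕ S S ⨾ₜ (q ⊕ p))     ≈⟨ assoc _ _ _ ⟨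
      (Δ S ⨾ₜ σ⊕ S S) ⨾ₜ (q ⊕ p)     ≈⟨ ⨾-cong (Δ-comm S) ≈refl ⟩
      ⟨ q , p ⟩                      ∎

    ⟨⟩-!ʳ : ∀ {A} (p : Tape Sg S A) → ⟨ p , ! S ⟩ ≈ₜ p
    ⟨⟩-!ʳ {A} p = begin
      ⟨ p , ! S ⟩                        ≈⟨ idʳ _ ⟨
      ⟨ p , ! S ⟩ ⨾ₜ pid (A ++ [])       ≈⟨ ⨾-cong ≈refl pid≈σ⊕ ⟩
      ⟨ p , ! S ⟩ ⨾ₜ σ⊕ A []             ≈⟨ ⟨⟩-σ⊕ p (! S) ⟩
      ⟨ ! S , p ⟩                        ≈⟨ ⟨⟩-!ˡ p ⟩
      p                                  ∎
      where
      pid≈σ⊕ : pid (A ++ []) ≈ₜ σ⊕ A []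
      pid≈σ⊕ = ≈trans (≈sym (⊕-id A [])) (≈trans (⊕-unitʳ (pid A)) (≈sym (σ-unit A)))

    ⟨⟩-0ₜ : ∀ A B → ⟨ 0ₜ A , 0ₜ B ⟩ ≈ₜ 0ₜ (A ++ B)
    ⟨⟩-0ₜ A B = begin
      ⟨ ! S ⨾ₜ ¡ A , ! S ⨾ₜ ¡ B ⟩          ≈⟨ ⟨⟩-⨾ (! S) (! S) (¡ A) (¡ B) ⟨
      ⟨ ! S , ! S ⟩ ⨾ₜ (¡ A ⊕ ¡ B)         ≈⟨ ⨾-cong (⨾-cong ≈refl (≈sym (!-⊕ S S))) (≈sym (¡-⊕ A B)) ⟩
      (Δ S ⨾ₜ ! (S ++ S)) ⨾ₜ ¡ (A ++ B)    ≈⟨ ⨾-cong (!-nat (Δ S)) ≈refl ⟩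
      0ₜ (A ++ B)                          ∎

    +ₜ-cong : ∀ {A} {p q p′ q′ : Tape Sg S A} → p ≈ₜ p′ → q ≈ₜ q′ → p +ₜ q ≈ₜ p′ +ₜ q′
    +ₜ-cong e e′ = ⨾-cong (⟨⟩-cong e e′) ≈refl

    +ₜ-⨾ : ∀ {A B} (p q : Tape Sg S A) (r : Tape Sg A B) → (p +ₜ q) ⨾ₜ r ≈ₜ (p ⨾ₜ r) +ₜ (q ⨾ₜ r)
    +ₜ-⨾ {A} {B} p q r = begin
      (⟨ p , q ⟩ ⨾ₜ ∇ A) ⨾ₜ r          ≈⟨ assoc _ _ _ ⟩
      ⟨ p , q ⟩ ⨾ₜ (∇ A ⨾ₜ r)          ≈⟨ ⨾-cong ≈refl (∇-nat r) ⟩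
      ⟨ p , q ⟩ ⨾ₜ ((r ⊕ r) ⨾ₜ ∇ B)    ≈⟨ assoc _ _ _ ⟨
      (⟨ p , q ⟩ ⨾ₜ (r ⊕ r)) ⨾ₜ ∇ B    ≈⟨ ⨾-cong (⟨⟩-⨾ p q r r) ≈refl ⟩
      (p ⨾ₜ r) +ₜ (q ⨾ₜ r)             ∎

    0ₜ-⨾ : ∀ {A B} (r : Tape Sg A B) → 0ₜ A ⨾ₜ r ≈ₜ 0ₜ B
    0ₜ-⨾ r = ≈trans (assoc _ _ _) (⨾-cong ≈refl (¡-nat r))

    +ₜ-identityˡ : ∀ {A} (q : Tape Sg S A) → 0ₜ A +ₜ q ≈ₜ q
    +ₜ-identityˡ {A} q = begin
      ⟨ ! S ⨾ₜ ¡ A , q ⟩ ⨾ₜ ∇ A              ≈⟨ ⨾-cong (⟨⟩-cong ≈refl (≈sym (idʳ q))) ≈refl ⟩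
      ⟨ ! S ⨾ₜ ¡ A , q ⨾ₜ pid A ⟩ ⨾ₜ ∇ A     ≈⟨ ⨾-cong (⟨⟩-⨾ (! S) q (¡ A) (pid A)) ≈refl ⟨
      (⟨ ! S , q ⟩ ⨾ₜ (¡ A ⊕ pid A)) ⨾ₜ ∇ A  ≈⟨ assoc _ _ _ ⟩
      ⟨ ! S , q ⟩ ⨾ₜ ((¡ A ⊕ pid A) ⨾ₜ ∇ A)  ≈⟨ ⨾-cong (⟨⟩-!ˡ q) (∇-unit A) ⟩
      q ⨾ₜ pid A                             ≈⟨ idʳ q ⟩
      q                                      ∎

    +ₜ-comm : ∀ {A} (p q : Tape Sg S A) → p +ₜ q ≈ₜ q +ₜ p
    +ₜ-comm {A} p q = begin
      ⟨ p , q ⟩ ⨾ₜ ∇ A                 ≈⟨ ⨾-cong ≈refl (∇-comm A) ⟨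
      ⟨ p , q ⟩ ⨾ₜ (σ⊕ A A ⨾ₜ ∇ A)     ≈⟨ assoc _ _ _ ⟨
      (⟨ p , q ⟩ ⨾ₜ σ⊕ A A) ⨾ₜ ∇ A     ≈⟨ ⨾-cong (⟨⟩-σ⊕ p q) ≈refl ⟩
      q +ₜ p                           ∎

    +ₜ-assoc : ∀ {A} (p q r : Tape Sg S A) → (p +ₜ q) +ₜ r ≈ₜ p +ₜ (q +ₜ r)
    +ₜ-assoc {A} p q r = begin
      ⟨ ⟨ p , q ⟩ ⨾ₜ ∇ A , r ⟩ ⨾ₜ ∇ A             ≈⟨ ⨾-cong (⟨⟩-cong ≈refl (≈sym (idʳ r))) ≈refl ⟩
      ⟨ ⟨ p , q ⟩ ⨾ₜ ∇ A , r ⨾ₜ pid A ⟩ ⨾ₜ ∇ A    ≈⟨ ⨾-cong (⟨⟩-⨾ _ _ _ _) ≈refl ⟨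
      (⟨ ⟨ p , q ⟩ , r ⟩ ⨾ₜ (∇ A ⊕ pid A)) ⨾ₜ ∇ A  ≈⟨ assoc _ _ _ ⟩
      ⟨ ⟨ p , q ⟩ , r ⟩ ⨾ₜ ((∇ A ⊕ pid A) ⨾ₜ ∇ A)  ≈⟨ ⨾-cong (≈sym (⟨⟩-assoc p q r)) (∇-assoc A) ⟩
      ⟨ p , ⟨ q , r ⟩ ⟩ ⨾ₜ ((pid A ⊕ ∇ A) ⨾ₜ ∇ A)  ≈⟨ assoc _ _ _ ⟨
      (⟨ p , ⟨ q , r ⟩ ⟩ ⨾ₜ (pid A ⊕ ∇ A)) ⨾ₜ ∇ A  ≈⟨ ⨾-cong (⟨⟩-⨾ _ _ _ _) ≈refl ⟩
      ⟨ p ⨾ₜ pid A , ⟨ q , r ⟩ ⨾ₜ ∇ A ⟩ ⨾ₜ ∇ A     ≈⟨ ⨾-cong (⟨⟩-cong (idʳ p) ≈refl) ≈refl ⟩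
      p +ₜ (q +ₜ r)                               ∎

    +ₜ-⟨⟩ : ∀ {A B} (p p′ : Tape Sg S A) (q q′ : Tape Sg S B) →
            ⟨ p , q ⟩ +ₜ ⟨ p′ , q′ ⟩ ≈ₜ ⟨ p +ₜ p′ , q +ₜ q′ ⟩
    +ₜ-⟨⟩ {A} {B} p p′ q q′ = begin
      ⟨ ⟨ p , q ⟩ , ⟨ p′ , q′ ⟩ ⟩ ⨾ₜ ∇ (A ++ B)
        ≈⟨ ⨾-cong regroup (∇-⊕ A B) ⟩
      ⟨ p , ⟨ ⟨ q , p′ ⟩ , q′ ⟩ ⟩ ⨾ₜ ((pid A ⊕ (σ⊕ B A ⊕ pid B)) ⨾ₜ merge)
        ≈⟨ assoc _ _ _ ⟨
      (⟨ p , ⟨ ⟨ q , p′ ⟩ , q′ ⟩ ⟩ ⨾ₜ (pid A ⊕ (σ⊕ B A ⊕ pid B))) ⨾ₜ merge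
        ≈⟨ ⨾-cong swapped (castT-≈ (sym (mid-eq Sg A B)) refl (∇ A ⊕ ∇ B)) ⟩
      ⟨ ⟨ p , p′ ⟩ , ⟨ q , q′ ⟩ ⟩ ⨾ₜ (∇ A ⊕ ∇ B)
        ≈⟨ ⟨⟩-⨾ _ _ _ _ ⟩
      ⟨ p +ₜ p′ , q +ₜ q′ ⟩ ∎
      where
      merge : Tape Sg (A ++ ((A ++ B) ++ B)) (A ++ B)
      merge = castT Sg (sym (mid-eq Sg A B)) refl (∇ A ⊕ ∇ B)
      castT-≈ : ∀ {X X′ Y Y′} (e : X ≡ X′) (e′ : Y ≡ Y′) (t : Tape Sg X Y) → castT Sg e e′ t ≈ₜ t
      castT-≈ refl refl t = ≈refl
      regroup : ⟨ ⟨ p , q ⟩ , ⟨ p′ , q′ ⟩ ⟩ ≈ₜ ⟨ p , ⟨ ⟨ q , p′ ⟩ , q′ ⟩ ⟩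
      regroup = ≈trans (≈sym (⟨⟩-assoc p q _)) (⟨⟩-cong ≈refl (⟨⟩-assoc q p′ q′))
      swapped : ⟨ p , ⟨ ⟨ q , p′ ⟩ , q′ ⟩ ⟩ ⨾ₜ (pid A ⊕ (σ⊕ B A ⊕ pid B)) ≈ₜ ⟨ ⟨ p , p′ ⟩ , ⟨ q , q′ ⟩ ⟩
      swapped = begin
        ⟨ p , ⟨ ⟨ q , p′ ⟩ , q′ ⟩ ⟩ ⨾ₜ (pid A ⊕ (σ⊕ B A ⊕ pid B))
          ≈⟨ ≈trans (⟨⟩-⨾ _ _ _ _) (⟨⟩-cong (idʳ p) (⟨⟩-⨾ _ _ _ _)) ⟩
        ⟨ p , ⟨ ⟨ q , p′ ⟩ ⨾ₜ σ⊕ B A , q′ ⨾ₜ pid B ⟩ ⟩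
          ≈⟨ ⟨⟩-cong ≈refl (⟨⟩-cong (⟨⟩-σ⊕ q p′) (idʳ q′)) ⟩
        ⟨ p , ⟨ ⟨ p′ , q ⟩ , q′ ⟩ ⟩
          ≈⟨ ⟨⟩-cong ≈refl (⟨⟩-assoc p′ q q′) ⟨
        ⟨ p , ⟨ p′ , ⟨ q , q′ ⟩ ⟩ ⟩
          ≈⟨ ⟨⟩-assoc p p′ _ ⟩
        ⟨ ⟨ p , p′ ⟩ , ⟨ q , q′ ⟩ ⟩ ∎

    +ₜ-isCommutativeMonoid : ∀ A → IsCommutativeMonoid (_≈ₜ_ {S} {A}) _+ₜ_ (0ₜ A)
    +ₜ-isCommutativeMonoid A = isCommutativeMonoidˡ record
      { isSemigroup = record
        { isMagma = record
          { isEquivalence = record { refl = ≈refl ; sym = ≈sym ; trans = ≈trans }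
          ; ∙-cong = +ₜ-cong }
        ; assoc = +ₜ-assoc }
      ; identityˡ = +ₜ-identityˡ
      ; comm = +ₜ-comm }

  ⟦+ₜ⟧ : ∀ {S A W} (p q : Tape Sg S A) (v : Row W S) → ⟦ p +ₜ q ⟧ v ≡ ⟦ p ⟧ v +ᵣ ⟦ q ⟧ v
  ⟦+ₜ⟧ p q v rewrite ⟦⊕⟧-++⁺ p q v v = ⟦∇⟧-++⁺ (⟦ p ⟧ v) (⟦ q ⟧ v)

  TapeSetoid : Poly Sg → Poly Sg → Setoid _ _
  TapeSetoid X Y = record
    { Carrier = Tape Sg X Y
    ; _≈_ = _≈ₜ_
    ; isEquivalence = record { refl = ≈refl ; sym = ≈sym ; trans = ≈trans }
    }

  module _ {W : Word Sg} where

    Σₜ : ∀ {U} → Hom⁺ Sg W U → Tape Sg [ W ] [ U ]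
    Σₜ {U} x = foldr _+ₜ_ (0ₜ [ U ]) (map ⌈_⌉ x)

    Σₜ-cong : ∀ {U} {x y : Hom⁺ Sg W U} → x ≈⁺ y → Σₜ x ≈ₜ Σₜ y
    Σₜ-cong {U} x≈y = PermutationProperties.foldr-commMonoid (TapeSetoid [ W ] [ U ])
      (+ₜ-isCommutativeMonoid [ U ]) (↭ₚ.map⁺ (TapeSetoid [ W ] [ U ]) ⌈⌉-cong x≈y)

    Σₜ-++ : ∀ {U} (x y : Hom⁺ Sg W U) → Σₜ (x ++ y) ≈ₜ Σₜ x +ₜ Σₜ y
    Σₜ-++ [] y = ≈sym (+ₜ-identityˡ (Σₜ y))
    Σₜ-++ (f ∷ x) y = ≈trans (+ₜ-cong ≈refl (Σₜ-++ x y)) (≈sym (+ₜ-assoc _ _ _))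

    Σₜ-⨾ : ∀ {U V} (x : Hom⁺ Sg W U) (c : Diag Sg U V) → Σₜ x ⨾ₜ ⌈ c ⌉ ≈ₜ Σₜ (map (_⨾ c) x)
    Σₜ-⨾ [] c = 0ₜ-⨾ ⌈ c ⌉
    Σₜ-⨾ (f ∷ x) c = ≈trans (+ₜ-⨾ _ _ _) (+ₜ-cong (≈sym (⌈⨾⌉ f c)) (Σₜ-⨾ x c))

    ⟦Σₜ⟧ : ∀ {V} (x : Hom⁺ Sg W V) → ⟦ Σₜ x ⟧ (id⁺ Sg W ∷ []) ≋ x ∷ []
    ⟦Σₜ⟧ [] = ≋-refl
    ⟦Σₜ⟧ {V} (f ∷ x) = ≋-trans (≋-reflexive (⟦+ₜ⟧ ⌈ f ⌉ (Σₜ x) (id⁺ Sg W ∷ [])))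
                           (+ᵣ-cong (↭.prep {W} {V} (idˡ f) ↭.↭-refl ∷ []) (⟦Σₜ⟧ x))

    rowₜ : ∀ {X} → Row W X → Tape Sg [ W ] X
    rowₜ [] = ! [ W ]
    rowₜ (x ∷ v) = ⟨ Σₜ x , rowₜ v ⟩

    rowₜ-++⁺ : ∀ {X Y} (a : Row W X) (b : Row W Y) → rowₜ (++⁺ a b) ≈ₜ ⟨ rowₜ a , rowₜ b ⟩
    rowₜ-++⁺ [] b = ≈sym (⟨⟩-!ˡ (rowₜ b))
    rowₜ-++⁺ (x ∷ a) b = ≈trans (⟨⟩-cong ≈refl (rowₜ-++⁺ a b)) (⟨⟩-assoc _ _ _)

    rowₜ-0ᵣ : ∀ X → rowₜ (0ᵣ X) ≈ₜ 0ₜ X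
    rowₜ-0ᵣ [] = ≈sym (≈trans (⨾-cong ≈refl ¡-0) (idʳ _))
    rowₜ-0ᵣ (U ∷ X) = ≈trans (⟨⟩-cong ≈refl (rowₜ-0ᵣ X)) (⟨⟩-0ₜ [ U ] X)

    rowₜ-+ᵣ : ∀ {X} (a b : Row W X) → rowₜ a +ₜ rowₜ b ≈ₜ rowₜ (a +ᵣ b)
    rowₜ-+ᵣ [] [] = ≈trans (⨾-cong ≈refl ∇-0) (≈trans (idʳ _) (⟨⟩-!ʳ (! [ W ])))
    rowₜ-+ᵣ (x ∷ a) (y ∷ b) = ≈trans (+ₜ-⟨⟩ _ _ _ _) (⟨⟩-cong (≈sym (Σₜ-++ x y)) (rowₜ-+ᵣ a b))

    rowₜ-⨾ : ∀ {X Y} (t : Tape Sg X Y) (v : Row W X) → rowₜ v ⨾ₜ t ≈ₜ rowₜ (⟦ t ⟧ v)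
    rowₜ-⨾ (pid X) v = idʳ _
    rowₜ-⨾ ⌈ c ⌉ (x ∷ []) = ≈trans (⨾-cong (⟨⟩-!ʳ (Σₜ x)) ≈refl) (≈trans (Σₜ-⨾ x c) (≈sym (⟨⟩-!ʳ _)))
    rowₜ-⨾ (σ⊕ X Y) v with split X v
    ... | ++⁺-split a b rewrite ⟦σ⊕⟧-++⁺ a b =
      ≈trans (⨾-cong (rowₜ-++⁺ a b) ≈refl) (≈trans (⟨⟩-σ⊕ _ _) (≈sym (rowₜ-++⁺ b a)))
    rowₜ-⨾ (Δ X) v = ≈trans (Δ-nat (rowₜ v)) (≈sym (rowₜ-++⁺ v v))
    rowₜ-⨾ (! X) v = !-nat (rowₜ v)
    rowₜ-⨾ (∇ X) v with split X v
    ... | ++⁺-split a b rewrite ⟦∇⟧-++⁺ a b = ≈trans (⨾-cong (rowₜ-++⁺ a b) ≈refl) (rowₜ-+ᵣ a b)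
    rowₜ-⨾ (¡ X) [] = ≈sym (rowₜ-0ᵣ X)
    rowₜ-⨾ (t ⨾ₜ s) v = ≈trans (≈sym (assoc _ _ _)) (≈trans (⨾-cong (rowₜ-⨾ t v) ≈refl) (rowₜ-⨾ s (⟦ t ⟧ v)))
    rowₜ-⨾ (_⊕_ {X} t s) v with split X v
    ... | ++⁺-split a b rewrite ⟦⊕⟧-++⁺ t s a b =
      ≈trans (⨾-cong (rowₜ-++⁺ a b) ≈refl)
        (≈trans (⟨⟩-⨾ _ _ _ _) (≈trans (⟨⟩-cong (rowₜ-⨾ t a) (rowₜ-⨾ s b)) (≈sym (rowₜ-++⁺ _ _))))

  unitRow : ∀ U → Row U [ U ]
  unitRow U = id⁺ Sg U ∷ []

  Fₘ : ∀ {U V} → Tape Sg [ U ] [ V ] → Hom⁺ Sg U V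
  Fₘ t = head (⟦ t ⟧ (unitRow _))

  head-cong : ∀ {W V} {u w : Row W [ V ]} → u ≋ w → head u ≈⁺ head w
  head-cong (p ∷ []) = p

  ⟦⟧-unitRow : ∀ {U V} (t : Tape Sg [ U ] [ V ]) → ⟦ t ⟧ (unitRow U) ≡ Fₘ t ∷ []
  ⟦⟧-unitRow t with ⟦ t ⟧ (unitRow _)
  ... | x ∷ [] = refl

  Fₘ-cong : ∀ {U V} {t s : Tape Sg [ U ] [ V ]} → t ≈ₜ s → Fₘ t ≈⁺ Fₘ s
  Fₘ-cong e = head-cong (⟦⟧-sound e ≋-refl)

  ⨾⁺-identityʳ : ∀ {W V} (x : Hom⁺ Sg W V) → x ⨾⁺ id⁺ Sg V ≈⁺ x
  ⨾⁺-identityʳ {W} {V} [] = ↭.↭-refl {W} {V}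
  ⨾⁺-identityʳ {W} {V} (f ∷ x) = ↭.prep {W} {V} (idʳ f) (⨾⁺-identityʳ x)

  Fₘ-id : ∀ U → Fₘ (pid [ U ]) ≈⁺ id⁺ Sg U
  Fₘ-id U = ↭.↭-refl

  Fₘ-σ : ∀ U V → Fₘ ⌈ σ U V ⌉ ≈⁺ σ⁺ Sg U V
  Fₘ-σ U V = ↭.prep {U ++ V} {V ++ U} (idˡ (σ U V)) ↭.↭-refl

  Fₘ-⨾ : ∀ {U V Z} (t : Tape Sg [ U ] [ V ]) (s : Tape Sg [ V ] [ Z ]) → Fₘ (t ⨾ₜ s) ≈⁺ Fₘ t ⨾⁺ Fₘ s
  Fₘ-⨾ {U} {V} t s rewrite ⟦⟧-unitRow t | ⟦⟧-unitRow s = head-cong (begin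
    ⟦ s ⟧ (Fₘ t ∷ [])                  ≋⟨ ⟦⟧-cong s (↭.↭-sym (⨾⁺-identityʳ (Fₘ t)) ∷ []) ⟩
    ⟦ s ⟧ (Fₘ t ⨾ᵣ unitRow V)          ≋⟨ ⟦⟧-⨾ᵣ (Fₘ t) s (unitRow V) ⟩
    Fₘ t ⨾ᵣ ⟦ s ⟧ (unitRow V)          ≡⟨ cong (Fₘ t ⨾ᵣ_) (⟦⟧-unitRow s) ⟩
    Fₘ t ⨾ᵣ (Fₘ s ∷ [])                ∎)
    where open ≋-Reasoning

  Fₘ-⊗ : ∀ {U₁ V₁ U₂ V₂} (t : Tape Sg [ U₁ ] [ V₁ ]) (s : Tape Sg [ U₂ ] [ V₂ ]) →
         Fₘ (t ⊗ₘ s) ≈⁺ Fₘ t ⊗⁺ Fₘ s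
  Fₘ-⊗ {U₁} {V₁} {U₂} {V₂} t s = head-cong (begin
    ⟦ R Sg V₂ t ⟧ (⟦ L Sg U₁ s ⟧ (unitRow (U₁ ++ U₂)))
      ≋⟨ ⟦⟧-cong (R Sg V₂ t) (⟦⟧-cong (L Sg U₁ s) unit≋) ⟩
    ⟦ R Sg V₂ t ⟧ (⟦ L Sg U₁ s ⟧ (id⁺ Sg U₁ ⊗ᵣ unitRow U₂))
      ≋⟨ ⟦⟧-cong (R Sg V₂ t) (⟦L⟧-⊗ᵣ (id⁺ Sg U₁) s (unitRow U₂)) ⟩
    ⟦ R Sg V₂ t ⟧ (id⁺ Sg U₁ ⊗ᵣ ⟦ s ⟧ (unitRow U₂))
      ≡⟨ cong (λ u → ⟦ R Sg V₂ t ⟧ (id⁺ Sg U₁ ⊗ᵣ u)) (⟦⟧-unitRow s) ⟩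
    ⟦ R Sg V₂ t ⟧ (unitRow U₁ ᵣ⊗ Fₘ s)
      ≋⟨ ⟦R⟧-ᵣ⊗ (Fₘ s) t (unitRow U₁) ⟩
    ⟦ t ⟧ (unitRow U₁) ᵣ⊗ Fₘ s
      ≡⟨ cong (_ᵣ⊗ Fₘ s) (⟦⟧-unitRow t) ⟩
    (Fₘ t ⊗⁺ Fₘ s) ∷ [] ∎)
    where
    open ≋-Reasoning
    unit≋ : unitRow (U₁ ++ U₂) ≋ id⁺ Sg U₁ ⊗ᵣ unitRow U₂
    unit≋ = ↭.prep {U₁ ++ U₂} {U₁ ++ U₂} (≈sym (⊗-id U₁ U₂)) ↭.↭-refl ∷ []

  Fₘ-Σₜ : ∀ {U V} (x : Hom⁺ Sg U V) → Fₘ (Σₜ x) ≈⁺ x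
  Fₘ-Σₜ x = head-cong (⟦Σₜ⟧ x)

  Σₜ-Fₘ : ∀ {U V} (t : Tape Sg [ U ] [ V ]) → Σₜ (Fₘ t) ≈ₜ t
  Σₜ-Fₘ {U} t = begin
    Σₜ (Fₘ t)                      ≈⟨ ⟨⟩-!ʳ _ ⟨
    rowₜ (Fₘ t ∷ [])               ≈⟨ ≈reflexive (cong rowₜ (⟦⟧-unitRow t)) ⟨
    rowₜ (⟦ t ⟧ (unitRow U))       ≈⟨ rowₜ-⨾ t (unitRow U) ⟨
    rowₜ (unitRow U) ⨾ₜ t          ≈⟨ ⨾-cong rowₜ-unitRow ≈refl ⟩
    pid [ U ] ⨾ₜ t                 ≈⟨ idˡ t ⟩
    t                              ∎
    where
    open ≈ₜ-Reasoning
    ≈reflexive : ∀ {A B} {r r′ : Tape Sg A B} → r ≡ r′ → r ≈ₜ r′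
    ≈reflexive refl = ≈refl
    rowₜ-unitRow : rowₜ (unitRow U) ≈ₜ pid [ U ]
    rowₜ-unitRow = ≈trans (⟨⟩-!ʳ _) (≈trans (+ₜ-comm _ _) (≈trans (+ₜ-identityˡ ⌈ id U ⌉) (⌈id⌉ U)))

corollary6p7 : (Sg : Signature) → MnmIsoCplus Sg
corollary6p7 Sg = record
  { F      = Fₘ Sg
  ; G      = Σₜ Sg
  ; F-cong = Fₘ-cong Sg
  ; G-cong = Σₜ-cong Sg
  ; F-id   = Fₘ-id Sg
  ; F-⨾    = Fₘ-⨾ Sg
  ; F-⊗    = Fₘ-⊗ Sg
  ; F-σ    = Fₘ-σ Sg
  ; F∘G    = Fₘ-Σₜ Sg
  ; G∘F    = Σₜ-Fₘ Sg
  }
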